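{- Let $H$ be a finite simple graph containing vertices $u$, $v$, $x$ with $N_H(u)=\{x,v\}$ and $N_H(v)=\{u\}$, and let $H' = H-\{u,v\}$. Suppose $H'$ is connected and has at least $2$ vertices. If $\varepsilon(H')$ is pancyclic, then $\varepsilon(H)$ is pancyclic.
   Context: All graphs are finite and simple. A dominating set of a graph $G$ is a set $D\subseteq V(G)$ such that every vertex of $V(G)\setminus D$ has a neighbour in $D$. The TARS-graph $\varepsilon(G)$ has as vertices the dominating sets of $G$; two distinct dominating sets $X,Y$ are adjacent iff either (i) $Y$ is obtained from $X$ by adding or deleting a single vertex of $G$, or (ii) there are vertices $u\in X$ and $v\in Y\setminus X$ that are adjacent in $G$ with $Y=(X\cup\{v\})\setminus\{u\}$. A graph on $N$ vertices is pancyclic if it contains a cycle of length $\ell$ for every integer $\ell$ with $3\le \ell\le N$. $G-S$ denotes the subgraph induced by deleting the vertices of $S$. -}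

module Defs where

open import Data.Nat using (ℕ; suc; _≤_)
open import Data.Bool using (Bool; true; false; _∧_; _∨_; T)
open import Data.Fin using (Fin; zero; suc; inject₁; fromℕ)
open import Data.Fin.Subset using (Subset; _∈_; _∉_; _∪_; _-_; ⁅_⁆)
open import Data.Vec using (lookup)
open import Data.List using (allFin)
open import Data.Bool.ListAction using (all; any)
open import Data.Product using (Σ; Σ-syntax; ∃; ∃-syntax; _×_; proj₁)
open import Data.Sum using (_⊎_)
open import Relation.Binary.PropositionalEquality using (_≡_; _≢_)
open import Relation.Binary.Construct.Closure.ReflexiveTransitive using (Star)
open import Function.Definitions using (Injective)
open import Function.Bundles using (_↔_)

record SimpleGraph (n : ℕ) : Set where
  field
    adj    : Fin n → Fin n → Bool
    sym    : ∀ a b → adj a b ≡ adj b a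
    irrefl : ∀ a → adj a a ≡ false
open SimpleGraph public

Adj : ∀ {n} → SimpleGraph n → Fin n → Fin n → Set
Adj G a b = T (adj G a b)

Connected : ∀ {n} → SimpleGraph n → Set
Connected {n} G = ∀ (a b : Fin n) → Star (Adj G) a b

-- D is dominating: every vertex is in D or has a neighbour in D
-- (boolean unfolding, so that the proof of dominance is unique).
isDominating : ∀ {n} → SimpleGraph n → Subset n → Bool
isDominating {n} G D =
  all (λ w → lookup D w ∨ any (λ d → lookup D d ∧ adj G w d) (allFin n)) (allFin n)

Dominating : ∀ {n} → SimpleGraph n → Subset n → Set
Dominating G D = T (isDominating G D)

TarsAdj : ∀ {n} → SimpleGraph n → Subset n → Subset n → Set
TarsAdj {n} G X Y =
  X ≢ Y ×
  ( (∃[ w ] (w ∉ X × Y ≡ X ∪ ⁅ w ⁆))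
  ⊎ (∃[ w ] (w ∈ X × Y ≡ X - w))
  ⊎ (∃[ u ] ∃[ v ] (u ∈ X × v ∈ Y × v ∉ X × Adj G u v × Y ≡ (X ∪ ⁅ v ⁆) - u)))

TarsVertex : ∀ {n} → SimpleGraph n → Set
TarsVertex {n} G = Σ (Subset n) (Dominating G)

TarsEdge : ∀ {n} (G : SimpleGraph n) → TarsVertex G → TarsVertex G → Set
TarsEdge G p q = TarsAdj G (proj₁ p) (proj₁ q)

HasCycle : (V : Set) → (V → V → Set) → ℕ → Set
HasCycle V E ℓ = Σ ℕ λ k → suc k ≡ ℓ × Σ (Fin (suc k) → V) λ c →
  Injective _≡_ _≡_ c ×
  (∀ (i : Fin k) → E (c (inject₁ i)) (c (suc i))) ×
  E (c (fromℕ k)) (c zero)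

Pancyclic : (V : Set) → (V → V → Set) → Set
Pancyclic V E = ∀ (N : ℕ) → (Fin N ↔ V) → ∀ (ℓ : ℕ) → 3 ≤ ℓ → ℓ ≤ N → HasCycle V E ℓ

TarsPancyclic : ∀ {n} → SimpleGraph n → Set
TarsPancyclic G = Pancyclic (TarsVertex G) (TarsEdge G)

-- G' (on Fin m) is (an isomorphic copy of) the induced subgraph G - {u,v}:
-- ι is injective, its image is exactly V(G) \ {u,v}, and it preserves and
-- reflects adjacency.
IsDeletion2 : ∀ {n m} → SimpleGraph n → Fin n → Fin n → SimpleGraph m → (Fin m → Fin n) → Set
IsDeletion2 {n} {m} G u v G' ι =
  Injective _≡_ _≡_ ι ×
  (∀ a → ι a ≢ u × ι a ≢ v) ×
  (∀ w → w ≢ u → w ≢ v → ∃[ a ] ι a ≡ w) ×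
  (∀ a b → adj G' a b ≡ adj G (ι a) (ι b))

{-# OPTIONS --safe #-}
module Submission where

-- Write S = D ∩ V(H′) for a dominating set D of H. If u ∉ D then v ∈ D and S dominates H′;
-- otherwise S dominates H′ except possibly x, which u covers. So ε(H) consists of the sets
-- S ∪ {v}, S ∪ {u}, S ∪ {u, v} for S ∈ ε(H′), together with (S − x) ∪ {u} and (S − x) ∪ {u, v}
-- for those S ∈ ε(H′) such that S − x dominates all of H′ but x. These sets form a small gadget
-- graph over each S, and every edge of ε(H′) lifts to the three sets S ∪ {v}, S ∪ {u},
-- S ∪ {u, v}. Replacing each vertex of a c-cycle of ε(H′) by a walk through its gadget that
-- visits up to 1 (in the larger gadgets up to 3) extra sets gives cycles of ε(H) of every
-- length 2c + R, R at most the total spare capacity. Pancyclicity of ε(H′) gives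
-- the lengths 2c and 2c + 1 for 2 ≤ c ≤ |ε(H′)|, a triangle in one gadget gives length 3, and
-- blowing up a Hamiltonian cycle of ε(H′) reaches every length up to |ε(H)|, because that
-- cycle meets every gadget.

open import Defs hiding (sym)
open import Data.Nat using (ℕ; zero; suc; _+_; _∸_; _⊓_; _≤_; z≤n; s≤s; _≤?_)
import Data.Nat as ℕ
open import Data.Nat.Properties
  using (≤-refl; ≤-trans; <⇒≤; <-irrefl; ≰⇒>; m≤n⇒m<n∨m≡n; +-suc; +-mono-≤; m≤m+n)
open import Data.Nat.Properties using (m⊓n≤m; m⊓n≤n; m+[n∸m]≡n; n≤0⇒n≡0; m≤n+o⇒m∸n≤o)
open import Data.Nat.ListAction using (sum)
open import Data.Nat.Tactic.RingSolver using (solve-∀)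
open import Data.Bool using (Bool; true; false; T; _∧_; _∨_; not)
open import Data.Bool.Properties using (T?; T-∧; T-∨; T-≡; T-not-≡; ∨-zeroʳ; ∨-identityʳ)
open import Data.Bool.ListAction using (all; any)
open import Data.Unit using (⊤; tt)
open import Data.Empty using (⊥; ⊥-elim)
open import Data.Fin using (Fin; zero; suc; inject₁; fromℕ)
import Data.Fin.Properties as Fin
open import Data.Fin.Properties using (_≟_; injective⇒≤)
open import Data.Fin.Subset using (Subset; _∈_; _∉_; _∪_; _-_; ⁅_⁆) renaming (⊤ to full)
open import Data.Fin.Subset.Properties
  using (p⊆p∪q; x∈p∪q⁺; x∈⁅x⁆; x∈p∧x≢y⇒x∈p-y; ∪-identityʳ; p─⊥≡p) renaming (∈⊤ to ∈full)
open import Data.Vec using (lookup; []; _∷_; _[_]≔_; tabulate)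
open import Data.Vec.Properties
  using (∷-injectiveʳ; lookup∘tabulate; tabulate∘lookup; tabulate-cong; []=⇒lookup; lookup⇒[]=)
open import Data.Vec.Properties using (lookup∘update; lookup∘update′; []≔-idempotent; []≔-lookup)
open import Data.Product using (Σ; Σ-syntax; ∃-syntax; _×_; _,_; proj₁; proj₂)
open import Data.Sum using (_⊎_; inj₁; inj₂)
open import Data.List using (List; []; _∷_; _++_; map; length; concatMap; allFin)
import Data.List as List
open import Data.List.Properties using (length-map; length-++; length-tabulate; ++-identityʳ; map-∘)
open import Data.List.Relation.Unary.All using (All; []; _∷_; universal)
import Data.List.Relation.Unary.All as All
import Data.List.Relation.Unary.All.Properties as All
open import Data.List.Relation.Unary.All.Properties using (¬Any⇒All¬; all-filter; all⁺; all⁻)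
open import Data.List.Relation.Unary.Any using (here; there; index; satisfied)
import Data.List.Relation.Unary.Any as Any
import Data.List.Relation.Unary.Any.Properties as Any
open import Data.List.Relation.Unary.Any.Properties using (lookup-index; any⁺; any⁻)
open import Data.List.Relation.Unary.Unique.Propositional using (Unique; []; _∷_)
import Data.List.Relation.Unary.Unique.Propositional.Properties as Unique
open import Data.List.Relation.Unary.Unique.DecPropositional ℕ._≟_ using (unique?)
open import Data.List.Membership.Propositional using (lose) renaming (_∈_ to _∈ₗ_)
open import Data.List.Membership.Propositional.Properties
  using (∈-lookup; ∈-allFin; ∈-map⁺; ∈-map⁻; ∈-++⁺ˡ; ∈-++⁺ʳ; ∈-filter⁺; ∈-concatMap⁺; ∈-concatMap⁻)
open import Data.List.Membership.DecPropositional using () renaming (_∈?_ to member?)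
open import Function using (_∘_; Equivalence)
open import Function.Bundles using (_↔_; Inverse; mk↔ₛ′)
open import Function.Definitions using (Injective)
open import Relation.Binary using (DecidableEquality; Symmetric)
open import Relation.Binary.Construct.Closure.ReflexiveTransitive using (ε; _◅_)
open import Relation.Binary.PropositionalEquality using (_≡_; _≢_; refl; sym; trans; cong; cong₂; subst)
open import Relation.Nullary using (¬_; yes; no)
open import Relation.Nullary.Decidable using (map′; True; toWitness)
open Relation.Binary.PropositionalEquality.≡-Reasoning

module _ {A : Set} where

  Chain : (A → A → Set) → A → List A → Set
  Chain R a []       = ⊤
  Chain R a (b ∷ bs) = R a b × Chain R b bs

  end : A → List A → A
  end a []       = a
  end a (b ∷ bs) = end b bs

  chain-++ : ∀ {R} a bs c cs → Chain R a bs → R (end a bs) c → Chain R c cs → Chain R a (bs ++ c ∷ cs)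
  chain-++ a []       c cs _          r ch = r , ch
  chain-++ a (b ∷ bs) c cs (r₀ , ch₀) r ch = r₀ , chain-++ b bs c cs ch₀ r ch

  end-++ : ∀ a bs c cs → end a (bs ++ c ∷ cs) ≡ end c cs
  end-++ a []       c cs = refl
  end-++ a (b ∷ bs) c cs = end-++ b bs c cs

  chain-lookup : ∀ {R} a bs → Chain R a bs →
                 ∀ (i : Fin (length bs)) → R (List.lookup (a ∷ bs) (inject₁ i)) (List.lookup (a ∷ bs) (suc i))
  chain-lookup a (b ∷ bs) (r , _)  zero    = r
  chain-lookup a (b ∷ bs) (_ , ch) (suc i) = chain-lookup b bs ch i

  lookup-fromℕ : ∀ a bs → List.lookup (a ∷ bs) (fromℕ (length bs)) ≡ end a bs
  lookup-fromℕ a []       = refl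
  lookup-fromℕ a (b ∷ bs) = lookup-fromℕ b bs

  chain-tabulate : ∀ {R} k (c : Fin (suc k) → A) → (∀ (i : Fin k) → R (c (inject₁ i)) (c (suc i))) →
                   Chain R (c zero) (List.tabulate (c ∘ suc))
  chain-tabulate zero    c step = tt
  chain-tabulate (suc k) c step = step zero , chain-tabulate k (c ∘ suc) (step ∘ suc)

  end-tabulate : ∀ k (c : Fin (suc k) → A) → end (c zero) (List.tabulate (c ∘ suc)) ≡ c (fromℕ k)
  end-tabulate zero    c = refl
  end-tabulate (suc k) c = end-tabulate k (c ∘ suc)

  lookup-injective : ∀ {xs : List A} → Unique xs → Injective _≡_ _≡_ (List.lookup xs)
  lookup-injective {x ∷ xs} (_   ∷ _) {zero}  {zero}  _ = refl
  lookup-injective {x ∷ xs} (x∉ ∷ _) {zero}  {suc j} e = ⊥-elim (All.lookup x∉ (∈-lookup j) e)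
  lookup-injective {x ∷ xs} (x∉ ∷ _) {suc i} {zero}  e = ⊥-elim (All.lookup x∉ (∈-lookup i) (sym e))
  lookup-injective {x ∷ xs} (_   ∷ u) {suc i} {suc j} e = cong suc (lookup-injective u e)

module _ {A B : Set} where

  chain-map : ∀ {R : A → A → Set} {S : B → B → Set} (f : A → B) → (∀ {a b} → R a b → S (f a) (f b)) →
              ∀ a bs → Chain R a bs → Chain S (f a) (map f bs)
  chain-map f hom a []       _        = tt
  chain-map f hom a (b ∷ bs) (r , ch) = hom r , chain-map f hom b bs ch

  end-map : ∀ (f : A → B) a bs → end (f a) (map f bs) ≡ f (end a bs)
  end-map f a []       = refl
  end-map f a (b ∷ bs) = end-map f b bs

chain-zip : ∀ {X Y Z : Set} {R : Y → Y → Set} {S : Z → Z → Set} (f : X → Y) (g : X → Z) a xs →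
            Chain R (f a) (map f xs) → Chain S (g a) (map g xs) → Chain (λ x y → R (f x) (f y) × S (g x) (g y)) a xs
chain-zip f g a []       _          _          = tt
chain-zip f g a (b ∷ xs) (r , ch₁) (s , ch₂) = (r , s) , chain-zip f g b xs ch₁ ch₂

record Cycle {A : Set} (E : A → A → Set) : Set where
  field
    start  : A
    rest   : List A
    chain  : Chain E start rest
    closes : E (end start rest) start
    unique : Unique (start ∷ rest)

  vertices : List A
  vertices = start ∷ rest

  size : ℕ
  size = length vertices

open Cycle

module _ {A : Set} {E : A → A → Set} where

  Cycle⇒HasCycle : (C : Cycle E) → HasCycle A E (size C)
  Cycle⇒HasCycle C =
    length (rest C) , refl , List.lookup (vertices C) , lookup-injective (unique C) ,
    chain-lookup (start C) (rest C) (chain C) ,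
    subst (λ z → E z (start C)) (sym (lookup-fromℕ (start C) (rest C))) (closes C)

  HasCycle⇒Cycle : ∀ {ℓ} → HasCycle A E ℓ → Σ[ C ∈ Cycle E ] size C ≡ ℓ
  HasCycle⇒Cycle (k , refl , c , c-injective , step , close) =
    record
      { start  = c zero
      ; rest   = List.tabulate (c ∘ suc)
      ; chain  = chain-tabulate k c step
      ; closes = subst (λ z → E z (c zero)) (sym (end-tabulate k c)) close
      ; unique = Unique.tabulate⁺ c-injective
      } ,
    cong suc (length-tabulate (c ∘ suc))

  digon : Symmetric E → (C : Cycle E) → 2 ≤ size C → Cycle E
  digon E-sym record { start = a ; rest = b ∷ _ ; chain = e , _ ; unique = (a∉ ∷ _) ∷ _ } _ =
    record { start = a ; rest = b ∷ [] ; chain = e , tt ; closes = E-sym e ; unique = (a∉ ∷ []) ∷ [] ∷ [] }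
  digon E-sym record { rest = [] } (s≤s ())

  size-digon : ∀ (E-sym : Symmetric E) (C : Cycle E) 2≤size → size (digon E-sym C 2≤size) ≡ 2
  size-digon E-sym record { rest = _ ∷ _ ; chain = _ , _ ; unique = (_ ∷ _) ∷ _ } _ = refl
  size-digon E-sym record { rest = [] } (s≤s ())

HasCycle-digon : ∀ {A : Set} {E : A → A → Set} {ℓ} → Symmetric E → HasCycle A E ℓ → 2 ≤ ℓ → HasCycle A E 2
HasCycle-digon {A} {E} E-sym cyc 2≤ℓ with HasCycle⇒Cycle {E = E} cyc
... | C , refl = subst (HasCycle A E) (size-digon E-sym C 2≤ℓ) (Cycle⇒HasCycle (digon E-sym C 2≤ℓ))

module _ {A B : Set} {E : A → A → Set} {F : B → B → Set} (f : A → B) (f-injective : Injective _≡_ _≡_ f)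
         (hom : ∀ {a b} → E a b → F (f a) (f b)) where

  mapCycle : Cycle E → Cycle F
  mapCycle C = record
    { start  = f (start C)
    ; rest   = map f (rest C)
    ; chain  = chain-map f hom (start C) (rest C) (chain C)
    ; closes = subst (λ z → F z (f (start C))) (sym (end-map f (start C) (rest C))) (hom (closes C))
    ; unique = Unique.map⁺ f-injective (unique C)
    }

  size-mapCycle : ∀ C → size (mapCycle C) ≡ size C
  size-mapCycle C = cong suc (length-map f (rest C))

module _ {A : Set} {P : A → Set} where

  On : (A → A → Set) → Σ A P → Σ A P → Set
  On E a b = E (proj₁ a) (proj₁ b)

  map-proj₁-toList : ∀ {xs} (ps : All P xs) → map proj₁ (All.toList ps) ≡ xs
  map-proj₁-toList []       = refl
  map-proj₁-toList (p ∷ ps) = cong (_ ∷_) (map-proj₁-toList ps)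

  length-toList : ∀ {xs} (ps : All P xs) → length (All.toList ps) ≡ length xs
  length-toList []       = refl
  length-toList (p ∷ ps) = cong suc (length-toList ps)

  chain-toList : ∀ {E} {a} (p : P a) {bs} → Chain E a bs → (ps : All P bs) → Chain (On E) (a , p) (All.toList ps)
  chain-toList p _        []       = tt
  chain-toList p (e , ch) (q ∷ qs) = e , chain-toList q ch qs

  end-toList : ∀ {a} (p : P a) {bs} (ps : All P bs) → proj₁ (end (a , p) (All.toList ps)) ≡ end a bs
  end-toList p []       = refl
  end-toList p (q ∷ qs) = end-toList q qs

  restrictCycle : ∀ {E} (C : Cycle E) → All P (vertices C) → Cycle (On E)
  restrictCycle {E} C (p ∷ ps) = record
    { start  = start C , p
    ; rest   = All.toList ps
    ; chain  = chain-toList p (chain C) ps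
    ; closes = subst (λ z → E z (start C)) (sym (end-toList p ps)) (closes C)
    ; unique = Unique.map⁻ (subst Unique (sym (cong (start C ∷_) (map-proj₁-toList ps))) (unique C))
    }

  size-restrictCycle : ∀ {E} (C : Cycle E) ps → size (restrictCycle C ps) ≡ size C
  size-restrictCycle C (p ∷ ps) = cong suc (length-toList ps)

T-irrelevant : ∀ {b} (p q : T b) → p ≡ q
T-irrelevant {true} _ _ = refl

Σ-T-≡ : ∀ {A : Set} {f : A → Bool} {a b : Σ A (T ∘ f)} → proj₁ a ≡ proj₁ b → a ≡ b
Σ-T-≡ {a = a , p} {b = .a , q} refl = cong (a ,_) (T-irrelevant p q)

module _ {A : Set} {N : ℕ} (enum : Fin N ↔ A) where
  open Inverse enum

  from-injective : Injective _≡_ _≡_ from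
  from-injective {a} {b} e = trans (sym (strictlyInverseˡ a)) (trans (cong to e) (strictlyInverseˡ b))

  to-injective : Injective _≡_ _≡_ to
  to-injective {i} {j} e = trans (sym (strictlyInverseʳ i)) (trans (cong from e) (strictlyInverseʳ j))

  ≟-from-↔ : DecidableEquality A
  ≟-from-↔ a b = map′ from-injective (cong from) (from a Fin.≟ from b)

  unique⇒length≤ : ∀ {xs} → Unique xs → length xs ≤ N
  unique⇒length≤ {xs} u = injective⇒≤ {f = from ∘ List.lookup xs} (lookup-injective u ∘ from-injective)

  complete⇒length≥ : ∀ {xs} → (∀ a → a ∈ₗ xs) → N ≤ length xs
  complete⇒length≥ {xs} complete = injective⇒≤ {f = index ∘ complete ∘ to} index-injective
    where
    index-injective : Injective _≡_ _≡_ (index ∘ complete ∘ to)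
    index-injective {i} {j} e = to-injective (begin
      to i                                     ≡⟨ lookup-index (complete (to i)) ⟩
      List.lookup xs (index (complete (to i))) ≡⟨ cong (List.lookup xs) e ⟩
      List.lookup xs (index (complete (to j))) ≡⟨ sym (lookup-index (complete (to j))) ⟩
      to j                                     ∎)

  unique⇒complete : ∀ {xs} → Unique xs → length xs ≡ N → ∀ a → a ∈ₗ xs
  unique⇒complete {xs} u len a with member? ≟-from-↔ a xs
  ... | yes a∈xs = a∈xs
  ... | no  a∉xs = ⊥-elim (<-irrefl refl (subst (λ k → suc k ≤ N) len (unique⇒length≤ (¬Any⇒All¬ xs a∉xs ∷ u))))

enumeration : ∀ {B : Set} (ys : List B) → Unique ys → (∀ b → b ∈ₗ ys) → Fin (length ys) ↔ B
enumeration ys u complete = mk↔ₛ′ (List.lookup ys) (index ∘ complete)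
  (λ b → sym (lookup-index (complete b)))
  (λ i → lookup-injective u (sym (lookup-index (complete (List.lookup ys i)))))

module _ {A : Set} (p : A → Bool) where

  satisfying : List A → List (Σ A (T ∘ p))
  satisfying xs = All.toList (all-filter (T? ∘ p) xs)

  bases-satisfying : ∀ xs → map proj₁ (satisfying xs) ≡ List.filter (T? ∘ p) xs
  bases-satisfying xs = map-proj₁-toList (all-filter (T? ∘ p) xs)

  satisfying-unique : ∀ {xs} → Unique xs → Unique (satisfying xs)
  satisfying-unique {xs} u = Unique.map⁻ (subst Unique (sym (bases-satisfying xs)) (Unique.filter⁺ (T? ∘ p) u))

  satisfying-complete : ∀ {xs} → (∀ a → a ∈ₗ xs) → ∀ a → a ∈ₗ satisfying xs
  satisfying-complete {xs} complete (a , pa)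
    with ∈-map⁻ proj₁ (subst (a ∈ₗ_) (sym (bases-satisfying xs)) (∈-filter⁺ (T? ∘ p) (complete a) pa))
  ... | b , b∈ , refl = subst (_∈ₗ satisfying xs) (Σ-T-≡ refl) b∈

∪⁅⁆≡[]≔ : ∀ {n} (X : Subset n) w → X ∪ ⁅ w ⁆ ≡ X [ w ]≔ true
∪⁅⁆≡[]≔ (b ∷ X) zero    = cong₂ _∷_ (∨-zeroʳ b) (∪-identityʳ X)
∪⁅⁆≡[]≔ (b ∷ X) (suc w) = cong₂ _∷_ (∨-identityʳ b) (∪⁅⁆≡[]≔ X w)

-≡[]≔ : ∀ {n} (X : Subset n) w → X - w ≡ X [ w ]≔ false
-≡[]≔ (b ∷ X) zero    = cong (false ∷_) (p─⊥≡p X)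
-≡[]≔ (b ∷ X) (suc w) = cong (b ∷_) (-≡[]≔ X w)

module _ {n : ℕ} where

  ≡-pointwise : ∀ {X Y : Subset n} → (∀ w → lookup X w ≡ lookup Y w) → X ≡ Y
  ≡-pointwise {X} {Y} eq = trans (sym (tabulate∘lookup X)) (trans (tabulate-cong eq) (tabulate∘lookup Y))

  ∉⇒lookup≡false : ∀ {X : Subset n} {w} → w ∉ X → lookup X w ≡ false
  ∉⇒lookup≡false {X} {w} w∉X with lookup X w in eq
  ... | true  = ⊥-elim (w∉X (lookup⇒[]= w X eq))
  ... | false = refl

  lookup≡false⇒∉ : ∀ {X : Subset n} {w} → lookup X w ≡ false → w ∉ X
  lookup≡false⇒∉ eq w∈X with trans (sym ([]=⇒lookup w∈X)) eq
  ... | ()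

  lookup--≢ : ∀ (X : Subset n) {a w} → w ≢ a → lookup (X - a) w ≡ lookup X w
  lookup--≢ X {a} w≢a = trans (cong (λ Z → lookup Z _) (-≡[]≔ X a)) (lookup∘update′ w≢a X false)

  w∉X-w : ∀ (X : Subset n) w → w ∉ X - w
  w∉X-w X w = lookup≡false⇒∉ (trans (cong (λ Z → lookup Z w) (-≡[]≔ X w)) (lookup∘update w X false))

  w∈X∪⁅w⁆ : ∀ (X : Subset n) w → w ∈ X ∪ ⁅ w ⁆
  w∈X∪⁅w⁆ X w = x∈p∪q⁺ (inj₂ (x∈⁅x⁆ w))

  add-remove : ∀ {X : Subset n} {w} → w ∉ X → (X ∪ ⁅ w ⁆) - w ≡ X
  add-remove {X} {w} w∉X = begin
    (X ∪ ⁅ w ⁆) - w              ≡⟨ -≡[]≔ (X ∪ ⁅ w ⁆) w ⟩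
    (X ∪ ⁅ w ⁆) [ w ]≔ false     ≡⟨ cong (_[ w ]≔ false) (∪⁅⁆≡[]≔ X w) ⟩
    X [ w ]≔ true [ w ]≔ false   ≡⟨ []≔-idempotent X w ⟩
    X [ w ]≔ false               ≡⟨ cong (X [ w ]≔_) (sym (∉⇒lookup≡false w∉X)) ⟩
    X [ w ]≔ lookup X w          ≡⟨ []≔-lookup X w ⟩
    X                            ∎

  remove-add : ∀ {X : Subset n} {w} → w ∈ X → (X - w) ∪ ⁅ w ⁆ ≡ X
  remove-add {X} {w} w∈X = begin
    (X - w) ∪ ⁅ w ⁆              ≡⟨ ∪⁅⁆≡[]≔ (X - w) w ⟩
    (X - w) [ w ]≔ true          ≡⟨ cong (_[ w ]≔ true) (-≡[]≔ X w) ⟩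
    X [ w ]≔ false [ w ]≔ true   ≡⟨ []≔-idempotent X w ⟩
    X [ w ]≔ true                ≡⟨ cong (X [ w ]≔_) (sym ([]=⇒lookup w∈X)) ⟩
    X [ w ]≔ lookup X w          ≡⟨ []≔-lookup X w ⟩
    X                            ∎

-- Dominating sets and TARS-adjacency

Adj-sym : ∀ {n} (G : SimpleGraph n) {a b} → Adj G a b → Adj G b a
Adj-sym G {a} {b} = subst T (SimpleGraph.sym G a b)

Dominates : ∀ {n} → SimpleGraph n → Subset n → Fin n → Set
Dominates G D w = lookup D w ≡ true ⊎ ∃[ d ] (lookup D d ≡ true × Adj G w d)

module _ {n : ℕ} (G : SimpleGraph n) (D : Subset n) where

  dominating⇒dominates : Dominating G D → ∀ w → Dominates G D w
  dominating⇒dominates dom w = fromT (All.lookup (all⁺ _ (allFin n) dom) (∈-allFin w))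
    where
    fromT : T (lookup D w ∨ any (λ d → lookup D d ∧ adj G w d) (allFin n)) → Dominates G D w
    fromT t with Equivalence.to (T-∨ {lookup D w}) t
    ... | inj₁ w∈D = inj₁ (Equivalence.to T-≡ w∈D)
    ... | inj₂ t′  with satisfied (any⁻ _ (allFin n) t′)
    ...   | d , t″ with Equivalence.to (T-∧ {lookup D d}) t″
    ...     | d∈D , w~d = inj₂ (d , Equivalence.to T-≡ d∈D , w~d)

  dominates⇒dominating : (∀ w → Dominates G D w) → Dominating G D
  dominates⇒dominating dom = all⁻ _ {allFin n} (All.tabulate (λ {w} _ → toT (dom w)))
    where
    toT : ∀ {w} → Dominates G D w → T (lookup D w ∨ any (λ d → lookup D d ∧ adj G w d) (allFin n))
    toT         (inj₁ w∈D)          = Equivalence.from T-∨ (inj₁ (Equivalence.from T-≡ w∈D))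
    toT {w} (inj₂ (d , d∈D , w~d)) = Equivalence.from (T-∨ {lookup D w})
      (inj₂ (any⁺ _ (lose (∈-allFin d) (Equivalence.from T-∧ (Equivalence.from T-≡ d∈D , w~d)))))

dominates-mono : ∀ {n} (G : SimpleGraph n) {D D′ : Subset n} → (∀ w → lookup D w ≡ true → lookup D′ w ≡ true) →
                 ∀ {w} → Dominates G D w → Dominates G D′ w
dominates-mono G D⊆D′ (inj₁ w∈D)             = inj₁ (D⊆D′ _ w∈D)
dominates-mono G D⊆D′ (inj₂ (d , d∈D , w~d)) = inj₂ (d , D⊆D′ d d∈D , w~d)

dominating-∪ : ∀ {n} (G : SimpleGraph n) {X} Y → Dominating G X → Dominating G (X ∪ Y)
dominating-∪ G {X} Y dom =
  dominates⇒dominating G (X ∪ Y) (dominates-mono G {X} {X ∪ Y} X⊆X∪Y ∘ dominating⇒dominates G X dom)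
  where
  X⊆X∪Y : ∀ w → lookup X w ≡ true → lookup (X ∪ Y) w ≡ true
  X⊆X∪Y w w∈X = []=⇒lookup (p⊆p∪q Y (lookup⇒[]= w X w∈X))

subsets : ∀ k → List (Subset k)
subsets zero    = [] ∷ []
subsets (suc k) = map (true ∷_) (subsets k) ++ map (false ∷_) (subsets k)

∈-subsets : ∀ {k} (S : Subset k) → S ∈ₗ subsets k
∈-subsets []          = here refl
∈-subsets (true  ∷ S) = ∈-++⁺ˡ (∈-map⁺ (true ∷_) (∈-subsets S))
∈-subsets (false ∷ S) = ∈-++⁺ʳ _ (∈-map⁺ (false ∷_) (∈-subsets S))

subsets-unique : ∀ k → Unique (subsets k)
subsets-unique zero    = [] ∷ []
subsets-unique (suc k) =
  Unique.++⁺ (Unique.map⁺ ∷-injectiveʳ (subsets-unique k)) (Unique.map⁺ ∷-injectiveʳ (subsets-unique k)) disjoint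
  where
  disjoint : ∀ {S} → S ∈ₗ map (true ∷_) (subsets k) × S ∈ₗ map (false ∷_) (subsets k) → ⊥
  disjoint (S∈₁ , S∈₂) with ∈-map⁻ (true ∷_) S∈₁ | ∈-map⁻ (false ∷_) S∈₂
  ... | _ , _ , refl | _ , _ , ()

dominatingSets : ∀ {n} (G : SimpleGraph n) → List (TarsVertex G)
dominatingSets {n} G = satisfying (isDominating G) (subsets n)

enumerate-ε : ∀ {n} (G : SimpleGraph n) → Fin (length (dominatingSets G)) ↔ TarsVertex G
enumerate-ε {n} G = enumeration (dominatingSets G)
  (satisfying-unique (isDominating G) (subsets-unique n))
  (satisfying-complete (isDominating G) ∈-subsets)

module _ {n : ℕ} (G : SimpleGraph n) where

  ∈∉⇒≢ : ∀ {X Y : Subset n} {w} → w ∈ X → w ∉ Y → X ≢ Y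
  ∈∉⇒≢ w∈X w∉Y refl = w∉Y w∈X

  TarsAdj-add : ∀ {X w} → w ∉ X → TarsAdj G X (X ∪ ⁅ w ⁆)
  TarsAdj-add {X} {w} w∉X = (∈∉⇒≢ (w∈X∪⁅w⁆ X w) w∉X ∘ sym) , inj₁ (w , w∉X , refl)

  TarsAdj-remove : ∀ {X w} → w ∈ X → TarsAdj G X (X - w)
  TarsAdj-remove {X} {w} w∈X = ∈∉⇒≢ w∈X (w∉X-w X w) , inj₂ (inj₁ (w , w∈X , refl))

  TarsAdj-swap : ∀ {X a b} → a ∈ X → b ∉ X → Adj G a b → TarsAdj G X ((X ∪ ⁅ b ⁆) - a)
  TarsAdj-swap {X} {a} {b} a∈X b∉X a~b =
    ∈∉⇒≢ a∈X (w∉X-w (X ∪ ⁅ b ⁆) a) ,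
    inj₂ (inj₂ (a , b , a∈X , x∈p∧x≢y⇒x∈p-y (w∈X∪⁅w⁆ X b) (a≢b ∘ sym) , b∉X , a~b , refl))
    where
    a≢b : a ≢ b
    a≢b refl = b∉X a∈X

TarsAdj-sym : ∀ {n} (G : SimpleGraph n) {X Y} → TarsAdj G X Y → TarsAdj G Y X
TarsAdj-sym G {X} (_ , inj₁ (w , w∉X , refl)) =
  subst (TarsAdj G _) (add-remove w∉X) (TarsAdj-remove G (w∈X∪⁅w⁆ X w))
TarsAdj-sym G {X} (_ , inj₂ (inj₁ (w , w∈X , refl))) =
  subst (TarsAdj G _) (remove-add w∈X) (TarsAdj-add G (w∉X-w X w))
TarsAdj-sym G {X} (_ , inj₂ (inj₂ (a , b , a∈X , b∈Y , b∉X , a~b , refl))) =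
  subst (TarsAdj G _) swap-back (TarsAdj-swap G b∈Y (w∉X-w (X ∪ ⁅ b ⁆) a) (Adj-sym G a~b))
  where
  swap-back : (((X ∪ ⁅ b ⁆) - a) ∪ ⁅ a ⁆) - b ≡ X
  swap-back = begin
    (((X ∪ ⁅ b ⁆) - a) ∪ ⁅ a ⁆) - b   ≡⟨ cong (_- b) (remove-add (x∈p∪q⁺ (inj₁ a∈X))) ⟩
    (X ∪ ⁅ b ⁆) - b                   ≡⟨ add-remove b∉X ⟩
    X                                 ∎

TarsEdge-sym : ∀ {n} (G : SimpleGraph n) → Symmetric (TarsEdge G)
TarsEdge-sym G = TarsAdj-sym G

module _ {n : ℕ} (G : SimpleGraph n) where

  loopless : ∀ {a} → ¬ Adj G a a
  loopless {a} = subst T (SimpleGraph.irrefl G a)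

  neighbour : Connected G → ∀ {a b} → a ≢ b → ∃[ c ] Adj G a c
  neighbour conn {a} {b} a≢b with conn a b
  ... | ε       = ⊥-elim (a≢b refl)
  ... | a~c ◅ _ = _ , a~c

  full-dominating : Dominating G full
  full-dominating = dominates⇒dominating G full (λ w → inj₁ ([]=⇒lookup (∈full {x = w})))

  full-minus-dominating : ∀ {a c} → Adj G a c → Dominating G (full - a)
  full-minus-dominating {a} {c} a~c = dominates⇒dominating G (full - a) dominated
    where
    in-full-a : ∀ {w} → w ≢ a → lookup (full - a) w ≡ true
    in-full-a w≢a = []=⇒lookup (x∈p∧x≢y⇒x∈p-y ∈full w≢a)
    dominated : ∀ w → Dominates G (full - a) w
    dominated w with w ≟ a
    ... | yes refl = inj₂ (c , in-full-a (λ { refl → loopless a~c }) , a~c)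
    ... | no  w≢a  = inj₁ (in-full-a w≢a)

  three≤#dominatingSets : Connected G → 2 ≤ n → 3 ≤ length (dominatingSets G)
  three≤#dominatingSets conn (s≤s (s≤s _)) = unique⇒length≤ (enumerate-ε G) distinct
    where
    D₀ D₁ : TarsVertex G
    D₀ = full - zero     , full-minus-dominating (proj₂ (neighbour conn {zero} {suc zero} (λ ())))
    D₁ = full - suc zero , full-minus-dominating (proj₂ (neighbour conn {suc zero} {zero} (λ ())))
    D : TarsVertex G
    D = full , full-dominating
    full≢full-a : ∀ a → full ≢ full - a
    full≢full-a a = ∈∉⇒≢ G ∈full (w∉X-w full a)
    full-1≢full-0 : full - suc zero ≢ full - zero
    full-1≢full-0 = ∈∉⇒≢ G (x∈p∧x≢y⇒x∈p-y {y = suc zero} ∈full λ ()) (w∉X-w full zero)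
    distinct : Unique (D ∷ D₀ ∷ D₁ ∷ [])
    distinct = ((full≢full-a zero ∘ cong proj₁) ∷ (full≢full-a (suc zero) ∘ cong proj₁) ∷ [])
             ∷ ((full-1≢full-0 ∘ sym ∘ cong proj₁) ∷ [])
             ∷ [] ∷ []

-- Inflating a cycle

module Inflation {V L : Set} (E : V → V → Set) (_~_ : L → L → Set) (Main : L → Set) where

  Edge : V × L → V × L → Set
  Edge (t , l) (t′ , l′) = (t ≡ t′ × l ~ l′) ⊎ (l ≡ l′ × Main l × E t t′)

  record Segment : Set where
    constructor segment
    field
      base  : V
      entry : L
      path  : List L

    exit : L
    exit = end entry path

    codes : List (V × L)
    codes = map (base ,_) (entry ∷ path)

  open Segment

  WellFormed : Segment → Set
  WellFormed s = Chain _~_ (entry s) (path s) × Unique (entry s ∷ path s)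

  Linked : Segment → Segment → Set
  Linked s s′ = E (base s) (base s′) × exit s ≡ entry s′ × Main (exit s)

  allCodes : List Segment → List (V × L)
  allCodes = concatMap codes

  private
    inner : ∀ s → WellFormed s → Chain Edge (base s , entry s) (map (base s ,_) (path s))
    inner s (ch , _) = chain-map (base s ,_) (λ r → inj₁ (refl , r)) (entry s) (path s) ch

    inner-end : ∀ s → end (base s , entry s) (map (base s ,_) (path s)) ≡ (base s , exit s)
    inner-end s = end-map (base s ,_) (entry s) (path s)

  chain-allCodes : ∀ s ss → All WellFormed (s ∷ ss) → Chain Linked s ss →
                   Chain Edge (base s , entry s) (map (base s ,_) (path s) ++ allCodes ss) ×
                   end (base s , entry s) (map (base s ,_) (path s) ++ allCodes ss) ≡ (base (end s ss) , exit (end s ss))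
  chain-allCodes s [] (wf ∷ []) _ rewrite ++-identityʳ (map (base s ,_) (path s)) = inner s wf , inner-end s
  chain-allCodes s (s′ ∷ ss) (wf ∷ wfs) ((E-ss′ , exit≡entry , main) , links) =
    chain-++ _ (map (base s ,_) (path s)) _ _ (inner s wf) link (proj₁ later) ,
    trans (end-++ _ (map (base s ,_) (path s)) _ _) (proj₂ later)
    where
    later = chain-allCodes s′ ss wfs links
    link : Edge (end (base s , entry s) (map (base s ,_) (path s))) (base s′ , entry s′)
    link = subst (λ c → Edge c (base s′ , entry s′)) (sym (inner-end s)) (inj₂ (exit≡entry , main , E-ss′))

  base-of : ∀ {c s} → c ∈ₗ codes s → proj₁ c ≡ base s
  base-of {s = s} c∈s with ∈-map⁻ (base s ,_) c∈s
  ... | _ , _ , refl = refl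

  allCodes-unique : ∀ ss → All WellFormed ss → Unique (map base ss) → Unique (allCodes ss)
  allCodes-unique []       []         _            = []
  allCodes-unique (s ∷ ss) ((_ , u) ∷ wfs) (s∉ss ∷ us) =
    Unique.++⁺ (Unique.map⁺ (cong proj₂) u) (allCodes-unique ss wfs us) disjoint
    where
    disjoint : ∀ {c} → c ∈ₗ codes s × c ∈ₗ allCodes ss → ⊥
    disjoint (c∈s , c∈ss) = Unique.Unique[x∷xs]⇒x∉xs (s∉ss ∷ us)
      (subst (_∈ₗ map base ss) (base-of c∈s) (Any.map⁺ (Any.map base-of (∈-concatMap⁻ codes {xs = ss} c∈ss))))

  length-allCodes : ∀ ss → length (allCodes ss) ≡ sum (map (suc ∘ length ∘ path) ss)
  length-allCodes []       = refl
  length-allCodes (s ∷ ss) =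
    trans (length-++ (codes s)) (cong₂ _+_ (cong suc (length-map (base s ,_) (path s))) (length-allCodes ss))

  inflate : ∀ s ss → Chain Linked s ss → Linked (end s ss) s → All WellFormed (s ∷ ss) → Unique (map base (s ∷ ss)) →
            Cycle Edge
  inflate s ss links closing wfs distinct = record
    { start  = base s , entry s
    ; rest   = map (base s ,_) (path s) ++ allCodes ss
    ; chain  = proj₁ walk
    ; closes = subst (λ c → Edge c (base s , entry s)) (sym (proj₂ walk)) (back {end s ss} closing)
    ; unique = allCodes-unique (s ∷ ss) wfs distinct
    }
    where
    walk = chain-allCodes s ss wfs links
    back : ∀ {s′} → Linked s′ s → Edge (base s′ , exit s′) (base s , entry s)
    back (E-s′s , exit≡entry , main) = inj₂ (exit≡entry , main , E-s′s)

  size-inflate : ∀ s ss links closing wfs distinct →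
                 size (inflate s ss links closing wfs distinct) ≡ sum (map (suc ∘ length ∘ path) (s ∷ ss))
  size-inflate s ss _ _ _ _ = length-allCodes (s ∷ ss)

-- The code (S , l) stands for the dominating set setOf S l of H: V, U and UV are S ∪ {v},
-- S ∪ {u} and S ∪ {u, v}, while U′ and UV′ are (S − x) ∪ {u} and (S − x) ∪ {u, v}.
data Letter : Set where
  V U UV U′ UV′ : Letter

_~_ : Letter → Letter → Set
V   ~ U   = ⊤
U   ~ V   = ⊤
V   ~ UV  = ⊤
UV  ~ V   = ⊤
U   ~ UV  = ⊤
UV  ~ U   = ⊤
V   ~ UV′ = ⊤
UV′ ~ V   = ⊤
UV  ~ UV′ = ⊤
UV′ ~ UV  = ⊤
U   ~ U′  = ⊤
U′  ~ U   = ⊤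
U′  ~ UV′ = ⊤
UV′ ~ U′  = ⊤
_   ~ _   = ⊥

Main : Letter → Set
Main V  = ⊤
Main U  = ⊤
Main UV = ⊤
Main _  = ⊥

allowed? : Bool → Letter → Bool
allowed? h U′  = h
allowed? h UV′ = h
allowed? h _   = true

capacity : Bool → ℕ
capacity false = 1
capacity true  = 3

data Turn : Set where
  V⇒U U⇒V V⇒UV UV⇒U : Turn

entryOf exitOf : Turn → Letter
entryOf V⇒U  = V
entryOf U⇒V  = U
entryOf V⇒UV = V
entryOf UV⇒U = UV
exitOf V⇒U  = U
exitOf U⇒V  = V
exitOf V⇒UV = UV
exitOf UV⇒U = U

exit-main : ∀ p → Main (exitOf p)
exit-main V⇒U  = _
exit-main U⇒V  = _
exit-main V⇒UV = _
exit-main UV⇒U = _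

route : Turn → ℕ → List Letter
route V⇒U  0 = U ∷ []
route V⇒U  1 = UV ∷ U ∷ []
route V⇒U  2 = UV′ ∷ UV ∷ U ∷ []
route V⇒U  _ = UV ∷ UV′ ∷ U′ ∷ U ∷ []
route U⇒V  0 = V ∷ []
route U⇒V  1 = UV ∷ V ∷ []
route U⇒V  2 = UV ∷ UV′ ∷ V ∷ []
route U⇒V  _ = U′ ∷ UV′ ∷ UV ∷ V ∷ []
route V⇒UV 0 = UV ∷ []
route V⇒UV 1 = U ∷ UV ∷ []
route V⇒UV _ = U ∷ U′ ∷ UV′ ∷ UV ∷ []
route UV⇒U 0 = U ∷ []
route UV⇒U 1 = V ∷ U ∷ []
route UV⇒U 2 = UV′ ∷ V ∷ U ∷ []
route UV⇒U _ = V ∷ UV′ ∷ U′ ∷ U ∷ []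

route-arrives : ∀ p e → end (entryOf p) (route p e) ≡ exitOf p
route-arrives V⇒U  0                   = refl
route-arrives V⇒U  1                   = refl
route-arrives V⇒U  2                   = refl
route-arrives V⇒U  (suc (suc (suc _))) = refl
route-arrives U⇒V  0                   = refl
route-arrives U⇒V  1                   = refl
route-arrives U⇒V  2                   = refl
route-arrives U⇒V  (suc (suc (suc _))) = refl
route-arrives V⇒UV 0                   = refl
route-arrives V⇒UV 1                   = refl
route-arrives V⇒UV (suc (suc _))       = refl
route-arrives UV⇒U 0                   = refl
route-arrives UV⇒U 1                   = refl
route-arrives UV⇒U 2                   = refl
route-arrives UV⇒U (suc (suc (suc _))) = refl

rank : Letter → ℕ
rank V   = 0
rank U   = 1
rank UV  = 2
rank U′  = 3
rank UV′ = 4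

record IsDetour (h : Bool) (p : Turn) (e : ℕ) : Set where
  field
    chain   : Chain _~_ (entryOf p) (route p e)
    allowed : All (T ∘ allowed? h) (entryOf p ∷ route p e)
    unique  : Unique (entryOf p ∷ route p e)
    length≡ : length (route p e) ≡ suc e

isDetour-by-computation : ∀ {h p e} → Chain _~_ (entryOf p) (route p e) → T (all (allowed? h) (entryOf p ∷ route p e)) →
                          True (unique? (map rank (entryOf p ∷ route p e))) → length (route p e) ≡ suc e → IsDetour h p e
isDetour-by-computation ch al un len = record
  { chain = ch ; allowed = all⁺ _ _ al ; unique = Unique.map⁻ (toWitness un) ; length≡ = len }

-- No walk V → _ → _ → UV through distinct letters exists, hence the side condition.
isDetour : ∀ p h e → e ≤ capacity h → p ≢ V⇒UV ⊎ e ≢ 2 → IsDetour h p e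
isDetour p     false (suc (suc e))             (s≤s ())                 _
isDetour p     true  (suc (suc (suc (suc e)))) (s≤s (s≤s (s≤s ())))     _
isDetour V⇒UV  h     2                         _  (inj₁ p≢) = ⊥-elim (p≢ refl)
isDetour V⇒UV  h     2                         _  (inj₂ e≢) = ⊥-elim (e≢ refl)
isDetour V⇒U   h     0 _ _ = isDetour-by-computation _ _ _ refl
isDetour V⇒U   h     1 _ _ = isDetour-by-computation _ _ _ refl
isDetour V⇒U   true  2 _ _ = isDetour-by-computation _ _ _ refl
isDetour V⇒U   true  3 _ _ = isDetour-by-computation _ _ _ refl
isDetour U⇒V   h     0 _ _ = isDetour-by-computation _ _ _ refl
isDetour U⇒V   h     1 _ _ = isDetour-by-computation _ _ _ refl
isDetour U⇒V   true  2 _ _ = isDetour-by-computation _ _ _ refl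
isDetour U⇒V   true  3 _ _ = isDetour-by-computation _ _ _ refl
isDetour V⇒UV  h     0 _ _ = isDetour-by-computation _ _ _ refl
isDetour V⇒UV  h     1 _ _ = isDetour-by-computation _ _ _ refl
isDetour V⇒UV  true  3 _ _ = isDetour-by-computation _ _ _ refl
isDetour UV⇒U  h     0 _ _ = isDetour-by-computation _ _ _ refl
isDetour UV⇒U  h     1 _ _ = isDetour-by-computation _ _ _ refl
isDetour UV⇒U  true  2 _ _ = isDetour-by-computation _ _ _ refl
isDetour UV⇒U  true  3 _ _ = isDetour-by-computation _ _ _ refl

letters : List Letter
letters = V ∷ U ∷ UV ∷ U′ ∷ UV′ ∷ []

∈-letters : ∀ l → l ∈ₗ letters
∈-letters V   = here refl
∈-letters U   = there (here refl)
∈-letters UV  = there (there (here refl))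
∈-letters U′  = there (there (there (here refl)))
∈-letters UV′ = there (there (there (there (here refl))))

data Even {X : Set} : List X → Set where
  nil   : Even []
  cons₂ : ∀ a b {r} → Even r → Even (a ∷ b ∷ r)

even-or-odd : ∀ {X : Set} (xs : List X) → Even xs ⊎ Σ[ a ∈ X ] Σ[ r ∈ List X ] xs ≡ a ∷ r × Even r
even-or-odd []       = inj₁ nil
even-or-odd (a ∷ xs) with even-or-odd xs
... | inj₁ ev                  = inj₂ (a , xs , refl , ev)
... | inj₂ (b , r , refl , ev) = inj₁ (cons₂ a b ev)

∸⊓≤ : ∀ R c {s} → R ≤ c + s → R ∸ R ⊓ c ≤ s
∸⊓≤ zero    c       _        = z≤n
∸⊓≤ (suc R) zero    le       = le
∸⊓≤ (suc R) (suc c) (s≤s le) = ∸⊓≤ R c le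

-- Only the first visit of a tour can take the turn V⇒UV, so its share of the budget avoids 2
-- and the later visits, each of capacity at least 1, absorb the difference.
firstShare : Bool → ℕ → ℕ
firstShare false zero                = 0
firstShare false (suc _)             = 1
firstShare true  0                   = 0
firstShare true  1                   = 1
firstShare true  2                   = 1
firstShare true  (suc (suc (suc _))) = 3

record FirstShareFits (h : Bool) (R s : ℕ) : Set where
  field
    ≤capacity : firstShare h R ≤ capacity h
    ≢2        : firstShare h R ≢ 2
    ≤total    : firstShare h R ≤ R
    remainder : R ∸ firstShare h R ≤ s

firstShare-fits : ∀ h R {s} → 1 ≤ s → R ≤ capacity h + s → FirstShareFits h R s
firstShare-fits false zero _ _ =
  record { ≤capacity = z≤n ; ≢2 = λ () ; ≤total = z≤n ; remainder = z≤n }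
firstShare-fits false (suc R) _ (s≤s R≤s) =
  record { ≤capacity = s≤s z≤n ; ≢2 = λ () ; ≤total = s≤s z≤n ; remainder = R≤s }
firstShare-fits true 0 _ _ =
  record { ≤capacity = z≤n ; ≢2 = λ () ; ≤total = z≤n ; remainder = z≤n }
firstShare-fits true 1 _ _ =
  record { ≤capacity = s≤s z≤n ; ≢2 = λ () ; ≤total = s≤s z≤n ; remainder = z≤n }
firstShare-fits true 2 1≤s _ =
  record { ≤capacity = s≤s z≤n ; ≢2 = λ () ; ≤total = s≤s z≤n ; remainder = 1≤s }
firstShare-fits true (suc (suc (suc R))) _ (s≤s (s≤s (s≤s R≤s))) =
  record { ≤capacity = s≤s (s≤s (s≤s z≤n)) ; ≢2 = λ () ; ≤total = s≤s (s≤s (s≤s z≤n)) ; remainder = R≤s }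

two-plus-shuffle : ∀ e l B → suc (suc e) + (l + l + B) ≡ suc l + suc l + (e + B)
two-plus-shuffle = solve-∀

-- Blowing up a cycle

module Blowup {X : Set} (E : X → X → Set) (replaceable : X → Bool) where
  open Inflation E _~_ Main public
  open Segment

  Allowed : X × Letter → Set
  Allowed (t , l) = T (allowed? (replaceable t) l)

  cap : X → ℕ
  cap = capacity ∘ replaceable

  Follows : Turn → Turn → Set
  Follows p q = exitOf p ≡ entryOf q

  Step : X × Turn → X × Turn → Set
  Step (t , p) (t′ , q) = E t t′ × Follows p q

  alternating : List X → List (X × Turn)
  alternating (a ∷ b ∷ r) = (a , V⇒U) ∷ (b , U⇒V) ∷ alternating r
  alternating _           = []

  bases-alternating : ∀ {r} → Even r → map proj₁ (alternating r) ≡ r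
  bases-alternating nil            = refl
  bases-alternating (cons₂ a b ev) = cong (λ z → a ∷ b ∷ z) (bases-alternating ev)

  follows-alternating : ∀ {r} → Even r → ∀ p → exitOf p ≡ V →
                        Chain Follows p (map proj₂ (alternating r)) × exitOf (end p (map proj₂ (alternating r))) ≡ V
  follows-alternating nil            p exit≡V = _ , exit≡V
  follows-alternating (cons₂ _ _ ev) p exit≡V = (exit≡V , refl , proj₁ later) , proj₂ later
    where later = follows-alternating ev U⇒V refl

  simple-alternating : ∀ {r} → Even r → All ((_≢ V⇒UV) ∘ proj₂) (alternating r)
  simple-alternating nil            = []
  simple-alternating (cons₂ _ _ ev) = (λ ()) ∷ (λ ()) ∷ simple-alternating ev

  record Labelling (t₀ : X) (ts : List X) : Set where
    field
      turn₀       : Turn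
      labels      : List (X × Turn)
      bases       : map proj₁ labels ≡ ts
      turns-chain : Chain Follows turn₀ (map proj₂ labels)
      turns-close : Follows (end turn₀ (map proj₂ labels)) turn₀
      simple      : All ((_≢ V⇒UV) ∘ proj₂) labels

  -- A cycle of odd length cannot alternate between V and U, so it takes one turn through UV.
  labelling : ∀ t₀ ts → 1 ≤ length ts → Labelling t₀ ts
  labelling t₀ ts nonempty with even-or-odd ts
  labelling t₀ [] () | inj₁ nil
  ... | inj₁ (cons₂ t₁ t₂ {r} ev) = record
    { turn₀       = V⇒UV
    ; labels      = (t₁ , UV⇒U) ∷ (t₂ , U⇒V) ∷ alternating r
    ; bases       = cong (λ z → t₁ ∷ t₂ ∷ z) (bases-alternating ev)
    ; turns-chain = refl , refl , proj₁ alt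
    ; turns-close = proj₂ alt
    ; simple      = (λ ()) ∷ (λ ()) ∷ simple-alternating ev
    }
    where alt = follows-alternating ev U⇒V refl
  ... | inj₂ (t₁ , r , refl , ev) = record
    { turn₀       = V⇒U
    ; labels      = (t₁ , U⇒V) ∷ alternating r
    ; bases       = cong (t₁ ∷_) (bases-alternating ev)
    ; turns-chain = refl , proj₁ alt
    ; turns-close = proj₂ alt
    ; simple      = (λ ()) ∷ simple-alternating ev
    }
    where alt = follows-alternating ev U⇒V refl

  Budget : X × Turn → Set
  Budget (t , p) = Σ[ e ∈ ℕ ] e ≤ cap t × (p ≢ V⇒UV ⊎ e ≢ 2)

  Visit : Set
  Visit = Σ (X × Turn) Budget

  budget : Visit → ℕ
  budget (_ , e , _) = e

  segmentOf : Visit → Segment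
  segmentOf ((t , p) , e , _) = segment t (entryOf p) (route p e)

  detourOf : ∀ v → IsDetour (replaceable (proj₁ (proj₁ v))) (proj₂ (proj₁ v)) (budget v)
  detourOf ((t , p) , e , e≤cap , feasible) = isDetour p (replaceable t) e e≤cap feasible

  wellFormed : ∀ v → WellFormed (segmentOf v)
  wellFormed v = IsDetour.chain (detourOf v) , IsDetour.unique (detourOf v)

  allowed-codes : ∀ v → All Allowed (codes (segmentOf v))
  allowed-codes v = All.map⁺ (IsDetour.allowed (detourOf v))

  linked : ∀ {v w} → On Step v w → Linked (segmentOf v) (segmentOf w)
  linked {(_ , p) , e , _} (E-tt′ , follows) =
    E-tt′ , trans (route-arrives p e) follows , subst Main (sym (route-arrives p e)) (exit-main p)

  length-segments : ∀ vs → sum (map (suc ∘ length ∘ path ∘ segmentOf) vs) ≡ length vs + length vs + sum (map budget vs)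
  length-segments []       = refl
  length-segments (v ∷ vs) = begin
    suc (length (path (segmentOf v))) + sum (map (suc ∘ length ∘ path ∘ segmentOf) vs)
      ≡⟨ cong₂ (λ a b → suc a + b) (IsDetour.length≡ (detourOf v)) (length-segments vs) ⟩
    suc (suc (budget v)) + (length vs + length vs + sum (map budget vs))
      ≡⟨ two-plus-shuffle (budget v) (length vs) _ ⟩
    suc (length vs) + suc (length vs) + (budget v + sum (map budget vs)) ∎

  greedy : ∀ R xs → All ((_≢ V⇒UV) ∘ proj₂) xs → All Budget xs
  greedy R []             []         = []
  greedy R ((t , p) ∷ xs) (p≢ ∷ ps) = (R ⊓ cap t , m⊓n≤n R (cap t) , inj₁ p≢) ∷ greedy (R ∸ R ⊓ cap t) xs ps

  sum-greedy : ∀ R xs ps → R ≤ sum (map cap (map proj₁ xs)) → sum (map budget (All.toList (greedy R xs ps))) ≡ R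
  sum-greedy R []             []         R≤0 = sym (n≤0⇒n≡0 R≤0)
  sum-greedy R ((t , p) ∷ xs) (_ ∷ ps) R≤  = begin
    R ⊓ cap t + sum (map budget (All.toList (greedy (R ∸ R ⊓ cap t) xs ps)))
      ≡⟨ cong (R ⊓ cap t +_) (sum-greedy (R ∸ R ⊓ cap t) xs ps (∸⊓≤ R (cap t) R≤)) ⟩
    R ⊓ cap t + (R ∸ R ⊓ cap t)
      ≡⟨ m+[n∸m]≡n (m⊓n≤m R (cap t)) ⟩
    R ∎

  capacity≥1 : ∀ h → 1 ≤ capacity h
  capacity≥1 false = s≤s z≤n
  capacity≥1 true  = s≤s z≤n

  capsum≥1 : ∀ ts → 1 ≤ length ts → 1 ≤ sum (map cap ts)
  capsum≥1 (t ∷ ts) _ = ≤-trans (capacity≥1 (replaceable t)) (m≤m+n (cap t) _)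

  bases-segments : ∀ vs → map base (map segmentOf vs) ≡ map (proj₁ ∘ proj₁) vs
  bases-segments []       = refl
  bases-segments (v ∷ vs) = cong (proj₁ (proj₁ v) ∷_) (bases-segments vs)

  record Tour (C : Cycle E) (R : ℕ) : Set where
    field
      first   : Visit
      others  : List Visit
      steps   : Chain (On Step) first others
      closing : On Step (end first others) first
      bases   : map (proj₁ ∘ proj₁) (first ∷ others) ≡ vertices C
      total   : sum (map budget (first ∷ others)) ≡ R

  tour : (C : Cycle E) → 2 ≤ size C → ∀ R → R ≤ sum (map cap (vertices C)) → Tour C R
  tour C (s≤s nonempty) R R≤ = record
    { first   = v₀
    ; others  = All.toList budgets
    ; steps   = chain-toList (proj₂ v₀) labelled-steps budgets
    ; closing = subst (λ y → Step y x₀) (sym (end-toList (proj₂ v₀) budgets)) closing-step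
    ; bases   = cong (t₀ ∷_) (trans (map-∘ (All.toList budgets)) (trans (cong (map proj₁) (map-proj₁-toList budgets)) bases))
    ; total   = trans (cong (e₀ +_) (sum-greedy (R ∸ e₀) labels simple (FirstShareFits.remainder fits)))
                      (m+[n∸m]≡n (FirstShareFits.≤total fits))
    }
    where
    open Labelling (labelling (start C) (rest C) nonempty)
    t₀ = start C
    x₀ = t₀ , turn₀
    capsum-rest : sum (map cap (map proj₁ labels)) ≡ sum (map cap (rest C))
    capsum-rest = cong (sum ∘ map cap) bases
    fits : FirstShareFits (replaceable t₀) R (sum (map cap (map proj₁ labels)))
    fits = firstShare-fits (replaceable t₀) R (subst (1 ≤_) (sym capsum-rest) (capsum≥1 (rest C) nonempty))
                                               (subst (λ s → R ≤ cap t₀ + s) (sym capsum-rest) R≤)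
    e₀ = firstShare (replaceable t₀) R
    v₀ : Visit
    v₀ = x₀ , e₀ , FirstShareFits.≤capacity fits , inj₂ (FirstShareFits.≢2 fits)
    budgets = greedy (R ∸ e₀) labels simple
    labelled-steps : Chain Step x₀ labels
    labelled-steps = chain-zip proj₁ proj₂ x₀ labels (subst (Chain E t₀) (sym bases) (chain C)) turns-chain
    closing-step : Step (end x₀ labels) x₀
    closing-step = subst (λ t → E t t₀) (trans (cong (end t₀) (sym bases)) (end-map proj₁ x₀ labels)) (closes C) ,
                   subst (λ p → Follows p turn₀) (end-map proj₂ x₀ labels) turns-close

  blowup : (C : Cycle E) → 2 ≤ size C → ∀ R → R ≤ sum (map cap (vertices C)) →
           Σ[ D ∈ Cycle Edge ] All Allowed (vertices D) × size D ≡ size C + size C + R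
  blowup C 2≤size R R≤ = D , allowed , size≡
    where
    open Tour (tour C 2≤size R R≤)
    segments = map segmentOf others
    links : Chain Linked (segmentOf first) segments
    links = chain-map segmentOf (λ {v} {w} → linked {v} {w}) first others steps
    closing-link : Linked (end (segmentOf first) segments) (segmentOf first)
    closing-link = subst (λ s → Linked s (segmentOf first)) (sym (end-map segmentOf first others))
                         (linked {end first others} {first} closing)
    wfs : All WellFormed (map segmentOf (first ∷ others))
    wfs = All.map⁺ (universal wellFormed (first ∷ others))
    distinct : Unique (map base (map segmentOf (first ∷ others)))
    distinct = subst Unique (sym (trans (bases-segments (first ∷ others)) bases)) (unique C)
    D : Cycle Edge
    D = inflate (segmentOf first) segments links closing-link wfs distinct
    allowed : All Allowed (vertices D)
    allowed = All.concat⁺ (All.map⁺ {f = codes} (All.map⁺ {f = segmentOf} (universal allowed-codes (first ∷ others))))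
    size≡ : size D ≡ size C + size C + R
    size≡ = begin
      size D
        ≡⟨ size-inflate (segmentOf first) segments links closing-link wfs distinct ⟩
      sum (map (suc ∘ length ∘ path) (map segmentOf (first ∷ others)))
        ≡⟨ cong sum (sym (map-∘ {g = suc ∘ length ∘ path} {f = segmentOf} (first ∷ others))) ⟩
      sum (map (suc ∘ length ∘ path ∘ segmentOf) (first ∷ others))
        ≡⟨ length-segments (first ∷ others) ⟩
      length (first ∷ others) + length (first ∷ others) + sum (map budget (first ∷ others))
        ≡⟨ cong₂ (λ l B → l + l + B) visits-size total ⟩
      size C + size C + R ∎
      where
      visits-size : length (first ∷ others) ≡ size C
      visits-size = trans (sym (length-map (proj₁ ∘ proj₁) (first ∷ others))) (cong length bases)

  ValidCode : Set
  ValidCode = Σ (X × Letter) Allowed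

  codesAt : X → List ValidCode
  codesAt t = map (λ (l , a) → (t , l) , a) (satisfying (allowed? (replaceable t)) letters)

  length-codesAt : ∀ t → length (codesAt t) ≡ suc (suc (cap t))
  length-codesAt t = trans (length-map _ (satisfying (allowed? (replaceable t)) letters)) (by-flag (replaceable t))
    where
    by-flag : ∀ h → length (satisfying (allowed? h) letters) ≡ suc (suc (capacity h))
    by-flag false = refl
    by-flag true  = refl

  allowedCodes : List X → List ValidCode
  allowedCodes = concatMap codesAt

  length-allowedCodes : ∀ ts → length (allowedCodes ts) ≡ length ts + length ts + sum (map cap ts)
  length-allowedCodes []       = refl
  length-allowedCodes (t ∷ ts) = begin
    length (codesAt t ++ allowedCodes ts)              ≡⟨ length-++ (codesAt t) ⟩
    length (codesAt t) + length (allowedCodes ts)      ≡⟨ cong₂ _+_ (length-codesAt t) (length-allowedCodes ts) ⟩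
    suc (suc (cap t)) + (length ts + length ts + sum (map cap ts)) ≡⟨ two-plus-shuffle (cap t) (length ts) _ ⟩
    suc (length ts) + suc (length ts) + (cap t + sum (map cap ts)) ∎

  ∈-allowedCodes : ∀ {ts} (c : ValidCode) → proj₁ (proj₁ c) ∈ₗ ts → c ∈ₗ allowedCodes ts
  ∈-allowedCodes {ts} c@((t , l) , a) t∈ts = ∈-concatMap⁺ codesAt (Any.map (λ { refl → c∈codesAt }) t∈ts)
    where
    c∈codesAt : c ∈ₗ codesAt t
    c∈codesAt = ∈-map⁺ (λ (l , a) → (t , l) , a) (satisfying-complete (allowed? (replaceable t)) ∈-letters (l , a))

  letterTriangle : X → Cycle Edge
  letterTriangle t = record
    { start  = t , V
    ; rest   = (t , U) ∷ (t , UV) ∷ []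
    ; chain  = inj₁ (refl , _) , inj₁ (refl , _) , _
    ; closes = inj₁ (refl , _)
    ; unique = ((λ ()) ∷ (λ ()) ∷ []) ∷ ((λ ()) ∷ []) ∷ [] ∷ []
    }

-- The pendant path x — u — v

module Pendant {n m : ℕ} (H : SimpleGraph n) (u v x : Fin n) (x≢v : x ≢ v)
  (hu : ∀ w → (Adj H u w → w ≡ x ⊎ w ≡ v) × (w ≡ x ⊎ w ≡ v → Adj H u w))
  (hv : ∀ w → (Adj H v w → w ≡ u) × (w ≡ u → Adj H v w))
  (H′ : SimpleGraph m) (ι : Fin m → Fin n) (del : IsDeletion2 H u v H′ ι) where

  ι-injective : ∀ {a b} → ι a ≡ ι b → a ≡ b
  ι-injective = proj₁ del

  ι≢u : ∀ a → ι a ≢ u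
  ι≢u a = proj₁ (proj₁ (proj₂ del) a)

  ι≢v : ∀ a → ι a ≢ v
  ι≢v a = proj₂ (proj₁ (proj₂ del) a)

  ι-onto : ∀ w → w ≢ u → w ≢ v → ∃[ a ] ι a ≡ w
  ι-onto = proj₁ (proj₂ (proj₂ del))

  ι-adj : ∀ a b → adj H′ a b ≡ adj H (ι a) (ι b)
  ι-adj = proj₂ (proj₂ (proj₂ del))

  u~v : Adj H u v
  u~v = proj₂ (hu v) (inj₂ refl)

  u~x : Adj H u x
  u~x = proj₂ (hu x) (inj₁ refl)

  v~u : Adj H v u
  v~u = proj₂ (hv u) refl

  u≢v : u ≢ v
  u≢v refl = loopless H u~v

  x≢u : x ≢ u
  x≢u refl = loopless H u~x

  data Location (w : Fin n) : Set where
    at-u : w ≡ u → Location w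
    at-v : w ≡ v → Location w
    at-ι : ∀ a → ι a ≡ w → Location w

  locate : ∀ w → Location w
  locate w with w ≟ u | w ≟ v
  ... | yes w≡u | _        = at-u w≡u
  ... | no  _   | yes w≡v  = at-v w≡v
  ... | no  w≢u | no  w≢v  = at-ι _ (proj₂ (ι-onto w w≢u w≢v))

  x′ : Fin m
  x′ = proj₁ (ι-onto x x≢u x≢v)

  ι-x′ : ι x′ ≡ x
  ι-x′ = proj₂ (ι-onto x x≢u x≢v)

  pick : Subset m → Bool → Bool → ∀ {w} → Location w → Bool
  pick S bu bv (at-u _)   = bu
  pick S bu bv (at-v _)   = bv
  pick S bu bv (at-ι a _) = lookup S a

  embed : Subset m → Bool → Bool → Subset n
  embed S bu bv = tabulate (pick S bu bv ∘ locate)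

  module _ (S : Subset m) (bu bv : Bool) where

    lookup-embed-u : lookup (embed S bu bv) u ≡ bu
    lookup-embed-u = trans (lookup∘tabulate _ u) (pick-u (locate u))
      where
      pick-u : (l : Location u) → pick S bu bv l ≡ bu
      pick-u (at-u _)      = refl
      pick-u (at-v u≡v)    = ⊥-elim (u≢v u≡v)
      pick-u (at-ι a ιa≡u) = ⊥-elim (ι≢u a ιa≡u)

    lookup-embed-v : lookup (embed S bu bv) v ≡ bv
    lookup-embed-v = trans (lookup∘tabulate _ v) (pick-v (locate v))
      where
      pick-v : (l : Location v) → pick S bu bv l ≡ bv
      pick-v (at-u v≡u)    = ⊥-elim (u≢v (sym v≡u))
      pick-v (at-v _)      = refl
      pick-v (at-ι a ιa≡v) = ⊥-elim (ι≢v a ιa≡v)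

    lookup-embed-ι : ∀ a → lookup (embed S bu bv) (ι a) ≡ lookup S a
    lookup-embed-ι a = trans (lookup∘tabulate _ (ι a)) (pick-ι (locate (ι a)))
      where
      pick-ι : (l : Location (ι a)) → pick S bu bv l ≡ lookup S a
      pick-ι (at-u ιa≡u)    = ⊥-elim (ι≢u a ιa≡u)
      pick-ι (at-v ιa≡v)    = ⊥-elim (ι≢v a ιa≡v)
      pick-ι (at-ι b ιb≡ιa) = cong (lookup S) (ι-injective ιb≡ιa)

  ≡embed : ∀ {X S bu bv} → lookup X u ≡ bu → lookup X v ≡ bv → (∀ a → lookup X (ι a) ≡ lookup S a) →
           X ≡ embed S bu bv
  ≡embed {X} {S} {bu} {bv} X-u X-v X-ι = ≡-pointwise pointwise
    where
    pointwise : ∀ w → lookup X w ≡ lookup (embed S bu bv) w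
    pointwise w with locate w
    ... | at-u refl   = trans X-u (sym (lookup-embed-u S bu bv))
    ... | at-v refl   = trans X-v (sym (lookup-embed-v S bu bv))
    ... | at-ι a refl = trans (X-ι a) (sym (lookup-embed-ι S bu bv a))

  trace : Subset n → Subset m
  trace X = tabulate (lookup X ∘ ι)

  lookup-trace : ∀ X a → lookup (trace X) a ≡ lookup X (ι a)
  lookup-trace X = lookup∘tabulate (lookup X ∘ ι)

  embed-trace : ∀ X → X ≡ embed (trace X) (lookup X u) (lookup X v)
  embed-trace X = ≡embed refl refl (sym ∘ lookup-trace X)

  trace-embed : ∀ S bu bv → trace (embed S bu bv) ≡ S
  trace-embed S bu bv = ≡-pointwise (λ a → trans (lookup-trace (embed S bu bv) a) (lookup-embed-ι S bu bv a))

  module _ (S : Subset m) (bu bv t : Bool) where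

    embed-[ι]≔ : ∀ a → embed S bu bv [ ι a ]≔ t ≡ embed (S [ a ]≔ t) bu bv
    embed-[ι]≔ a = ≡embed
      (trans (lookup∘update′ (ι≢u a ∘ sym) (embed S bu bv) t) (lookup-embed-u S bu bv))
      (trans (lookup∘update′ (ι≢v a ∘ sym) (embed S bu bv) t) (lookup-embed-v S bu bv))
      at-image
      where
      at-image : ∀ b → lookup (embed S bu bv [ ι a ]≔ t) (ι b) ≡ lookup (S [ a ]≔ t) b
      at-image b with b ≟ a
      ... | yes refl = trans (lookup∘update (ι a) (embed S bu bv) t) (sym (lookup∘update a S t))
      ... | no  b≢a  = begin
        lookup (embed S bu bv [ ι a ]≔ t) (ι b) ≡⟨ lookup∘update′ (b≢a ∘ ι-injective) (embed S bu bv) t ⟩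
        lookup (embed S bu bv) (ι b)            ≡⟨ lookup-embed-ι S bu bv b ⟩
        lookup S b                              ≡⟨ sym (lookup∘update′ b≢a S t) ⟩
        lookup (S [ a ]≔ t) b                   ∎

    embed-[u]≔ : embed S bu bv [ u ]≔ t ≡ embed S t bv
    embed-[u]≔ = ≡embed
      (lookup∘update u (embed S bu bv) t)
      (trans (lookup∘update′ (u≢v ∘ sym) (embed S bu bv) t) (lookup-embed-v S bu bv))
      (λ a → trans (lookup∘update′ (ι≢u a) (embed S bu bv) t) (lookup-embed-ι S bu bv a))

    embed-[v]≔ : embed S bu bv [ v ]≔ t ≡ embed S bu t
    embed-[v]≔ = ≡embed
      (trans (lookup∘update′ u≢v (embed S bu bv) t) (lookup-embed-u S bu bv))
      (lookup∘update v (embed S bu bv) t)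
      (λ a → trans (lookup∘update′ (ι≢v a) (embed S bu bv) t) (lookup-embed-ι S bu bv a))

  module _ (S : Subset m) (bu bv : Bool) where

    embed-∪-ι : ∀ a → embed S bu bv ∪ ⁅ ι a ⁆ ≡ embed (S ∪ ⁅ a ⁆) bu bv
    embed-∪-ι a = trans (∪⁅⁆≡[]≔ _ (ι a))
      (trans (embed-[ι]≔ S bu bv true a) (cong (λ Z → embed Z bu bv) (sym (∪⁅⁆≡[]≔ S a))))

    embed---ι : ∀ a → embed S bu bv - ι a ≡ embed (S - a) bu bv
    embed---ι a = trans (-≡[]≔ _ (ι a))
      (trans (embed-[ι]≔ S bu bv false a) (cong (λ Z → embed Z bu bv) (sym (-≡[]≔ S a))))

    embed-∪-u : embed S bu bv ∪ ⁅ u ⁆ ≡ embed S true bv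
    embed-∪-u = trans (∪⁅⁆≡[]≔ _ u) (embed-[u]≔ S bu bv true)

    embed---u : embed S bu bv - u ≡ embed S false bv
    embed---u = trans (-≡[]≔ _ u) (embed-[u]≔ S bu bv false)

    embed-∪-v : embed S bu bv ∪ ⁅ v ⁆ ≡ embed S bu true
    embed-∪-v = trans (∪⁅⁆≡[]≔ _ v) (embed-[v]≔ S bu bv true)

    embed---v : embed S bu bv - v ≡ embed S bu false
    embed---v = trans (-≡[]≔ _ v) (embed-[v]≔ S bu bv false)

    ι∈embed : ∀ {a} → a ∈ S → ι a ∈ embed S bu bv
    ι∈embed {a} a∈S = lookup⇒[]= (ι a) _ (trans (lookup-embed-ι S bu bv a) ([]=⇒lookup a∈S))

    ι∉embed : ∀ {a} → a ∉ S → ι a ∉ embed S bu bv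
    ι∉embed {a} a∉S = lookup≡false⇒∉ (trans (lookup-embed-ι S bu bv a) (∉⇒lookup≡false a∉S))

  lift-edge : ∀ {S S′} bu bv → TarsAdj H′ S S′ → TarsAdj H (embed S bu bv) (embed S′ bu bv)
  lift-edge {S} bu bv (_ , inj₁ (a , a∉S , refl)) =
    subst (TarsAdj H _) (embed-∪-ι S bu bv a) (TarsAdj-add H (ι∉embed S bu bv a∉S))
  lift-edge {S} bu bv (_ , inj₂ (inj₁ (a , a∈S , refl))) =
    subst (TarsAdj H _) (embed---ι S bu bv a) (TarsAdj-remove H (ι∈embed S bu bv a∈S))
  lift-edge {S} bu bv (_ , inj₂ (inj₂ (a , b , a∈S , _ , b∉S , a~b , refl))) =
    subst (TarsAdj H _) swapped (TarsAdj-swap H (ι∈embed S bu bv a∈S) (ι∉embed S bu bv b∉S) (subst T (ι-adj a b) a~b))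
    where
    swapped : (embed S bu bv ∪ ⁅ ι b ⁆) - ι a ≡ embed ((S ∪ ⁅ b ⁆) - a) bu bv
    swapped = trans (cong (_- ι a) (embed-∪-ι S bu bv b)) (embed---ι (S ∪ ⁅ b ⁆) bu bv a)

  add-u-edge : ∀ S bv → TarsAdj H (embed S false bv) (embed S true bv)
  add-u-edge S bv = subst (TarsAdj H _) (embed-∪-u S false bv) (TarsAdj-add H (lookup≡false⇒∉ (lookup-embed-u S false bv)))

  add-v-edge : ∀ S bu → TarsAdj H (embed S bu false) (embed S bu true)
  add-v-edge S bu = subst (TarsAdj H _) (embed-∪-v S bu false) (TarsAdj-add H (lookup≡false⇒∉ (lookup-embed-v S bu false)))

  slide-v-u-edge : ∀ S → TarsAdj H (embed S false true) (embed S true false)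
  slide-v-u-edge S = subst (TarsAdj H _) slid
    (TarsAdj-swap H (lookup⇒[]= v _ (lookup-embed-v S false true)) (lookup≡false⇒∉ (lookup-embed-u S false true)) v~u)
    where
    slid : (embed S false true ∪ ⁅ u ⁆) - v ≡ embed S true false
    slid = trans (cong (_- v) (embed-∪-u S false true)) (embed---v S true true)

  slide-u-x-edge : ∀ S → x′ ∉ S → TarsAdj H (embed S true true) (embed (S ∪ ⁅ x′ ⁆) false true)
  slide-u-x-edge S x′∉S = subst (TarsAdj H _) slid
    (TarsAdj-swap H (lookup⇒[]= u _ (lookup-embed-u S true true)) (ι∉embed S true true x′∉S)
                    (subst (Adj H u) (sym ι-x′) u~x))
    where
    slid : (embed S true true ∪ ⁅ ι x′ ⁆) - u ≡ embed (S ∪ ⁅ x′ ⁆) false true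
    slid = trans (cong (_- u) (embed-∪-ι S true true x′)) (embed---u (S ∪ ⁅ x′ ⁆) true true)

  dominates-ι : ∀ {D a} → Dominates H D (ι a) → Dominates H′ (trace D) a ⊎ (lookup D u ≡ true × a ≡ x′)
  dominates-ι {D} {a} (inj₁ ιa∈D) = inj₁ (inj₁ (trans (lookup-trace D a) ιa∈D))
  dominates-ι {D} {a} (inj₂ (d , d∈D , ιa~d)) with locate d
  ... | at-u refl   = inj₂ (d∈D , ι-injective (trans (ιa≡x (proj₁ (hu (ι a)) (Adj-sym H ιa~d))) (sym ι-x′)))
    where
    ιa≡x : ι a ≡ x ⊎ ι a ≡ v → ι a ≡ x
    ιa≡x (inj₁ ιa≡x)   = ιa≡x
    ιa≡x (inj₂ ιa≡v) = ⊥-elim (ι≢v a ιa≡v)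
  ... | at-v refl   = ⊥-elim (ι≢u a (proj₁ (hv (ι a)) (Adj-sym H ιa~d)))
  ... | at-ι b refl = inj₁ (inj₂ (b , trans (lookup-trace D b) d∈D , subst T (sym (ι-adj a b)) ιa~d))

  dominating-u∉ : ∀ D → Dominating H D → lookup D u ≡ false → lookup D v ≡ true × Dominating H′ (trace D)
  dominating-u∉ D dom u∉D =
    v∈D (dominated v) , dominates⇒dominating H′ (trace D) (λ a → traced (dominates-ι {D} (dominated (ι a))))
    where
    dominated : ∀ w → Dominates H D w
    dominated = dominating⇒dominates H D dom
    u∈D⇒⊥ : lookup D u ≡ true → ⊥
    u∈D⇒⊥ u∈D with trans (sym u∈D) u∉D
    ... | ()
    v∈D : Dominates H D v → lookup D v ≡ true
    v∈D (inj₁ v∈D)             = v∈D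
    v∈D (inj₂ (d , d∈D , v~d)) = ⊥-elim (u∈D⇒⊥ (subst (λ z → lookup D z ≡ true) (proj₁ (hv d) v~d) d∈D))
    traced : ∀ {a} → Dominates H′ (trace D) a ⊎ (lookup D u ≡ true × a ≡ x′) → Dominates H′ (trace D) a
    traced (inj₁ dominated′)   = dominated′
    traced (inj₂ (u∈D , _))    = ⊥-elim (u∈D⇒⊥ u∈D)

  module _ {S : Subset m} {bv : Bool} (dom : Dominating H (embed S true bv)) where

    dominated-but-x′ : ∀ a → Dominates H′ S a ⊎ a ≡ x′
    dominated-but-x′ a with dominates-ι {embed S true bv} (dominating⇒dominates H (embed S true bv) dom (ι a))
    ... | inj₁ dominated = inj₁ (subst (λ Z → Dominates H′ Z a) (trace-embed S true bv) dominated)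
    ... | inj₂ (_ , a≡x′) = inj₂ a≡x′

    dominating-∪x′ : Dominating H′ (S ∪ ⁅ x′ ⁆)
    dominating-∪x′ = dominates⇒dominating H′ (S ∪ ⁅ x′ ⁆) (λ a → extend (dominated-but-x′ a))
      where
      extend : ∀ {a} → Dominates H′ S a ⊎ a ≡ x′ → Dominates H′ (S ∪ ⁅ x′ ⁆) a
      extend (inj₁ dominated) =
        dominates-mono H′ {S} {S ∪ ⁅ x′ ⁆} (λ w w∈S → []=⇒lookup (p⊆p∪q ⁅ x′ ⁆ (lookup⇒[]= w S w∈S))) dominated
      extend (inj₂ refl)      = inj₁ ([]=⇒lookup (w∈X∪⁅w⁆ S x′))

    dominating-x′∈ : lookup S x′ ≡ true → Dominating H′ S
    dominating-x′∈ x′∈S = dominates⇒dominating H′ S (λ a → keep (dominated-but-x′ a))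
      where
      keep : ∀ {a} → Dominates H′ S a ⊎ a ≡ x′ → Dominates H′ S a
      keep (inj₁ dominated) = dominated
      keep (inj₂ refl)      = inj₁ x′∈S

  dominated-ι : ∀ {S} bu bv → Dominating H′ S → ∀ a → Dominates H (embed S bu bv) (ι a)
  dominated-ι {S} bu bv dom a with dominating⇒dominates H′ S dom a
  ... | inj₁ a∈S             = inj₁ (trans (lookup-embed-ι S bu bv a) a∈S)
  ... | inj₂ (b , b∈S , a~b) = inj₂ (ι b , trans (lookup-embed-ι S bu bv b) b∈S , subst T (ι-adj a b) a~b)

  dominating-V : ∀ {S} → Dominating H′ S → Dominating H (embed S false true)
  dominating-V {S} dom = dominates⇒dominating H (embed S false true) dominated
    where
    dominated : ∀ w → Dominates H (embed S false true) w
    dominated w with locate w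
    ... | at-u refl   = inj₂ (v , lookup-embed-v S false true , u~v)
    ... | at-v refl   = inj₁ (lookup-embed-v S false true)
    ... | at-ι a refl = dominated-ι false true dom a

  dominating-U : ∀ {S} → Dominating H′ S → Dominating H (embed S true false)
  dominating-U {S} dom = dominates⇒dominating H (embed S true false) dominated
    where
    dominated : ∀ w → Dominates H (embed S true false) w
    dominated w with locate w
    ... | at-u refl   = inj₁ (lookup-embed-u S true false)
    ... | at-v refl   = inj₂ (u , lookup-embed-u S true false , v~u)
    ... | at-ι a refl = dominated-ι true false dom a

  dominating-add-v : ∀ {S} → Dominating H (embed S true false) → Dominating H (embed S true true)
  dominating-add-v {S} = subst (Dominating H) (embed-∪-v S true false) ∘ dominating-∪ H {embed S true false} ⁅ v ⁆

  dominating-drop-v : ∀ {S} bv → Dominating H (embed S true bv) → Dominating H (embed S true false)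
  dominating-drop-v         false dom = dom
  dominating-drop-v {S} true  dom = dominates⇒dominating H D (drop ∘ dominating⇒dominates H (embed S true true) dom)
    where
    D = embed S true false
    u∈D : lookup D u ≡ true
    u∈D = lookup-embed-u S true false
    agree : ∀ {w} → w ≢ v → lookup (embed S true true) w ≡ true → lookup D w ≡ true
    agree {w} w≢v w∈ =
      trans (cong (λ Z → lookup Z w) (sym (embed---v S true true))) (trans (lookup--≢ (embed S true true) w≢v) w∈)
    drop : ∀ {w} → Dominates H (embed S true true) w → Dominates H D w
    drop {w} (inj₁ w∈) with w ≟ v
    ... | yes refl = inj₂ (u , u∈D , v~u)
    ... | no  w≢v  = inj₁ (agree w≢v w∈)
    drop {w} (inj₂ (d , d∈ , w~d)) with d ≟ v
    ... | yes refl = inj₁ (subst (λ z → lookup D z ≡ true) (sym (proj₁ (hv w) (Adj-sym H w~d))) u∈D)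
    ... | no  d≢v  = inj₂ (d , agree d≢v d∈ , w~d)

  -- The last conjunct keeps (S − x) ∪ {u} from already being the U-set of S − x.
  replaceable : Subset m → Bool
  replaceable S = lookup S x′ ∧ isDominating H (embed (S - x′) true false) ∧ not (isDominating H′ (S - x′))

  record Replaceable (S : Subset m) : Set where
    field
      x′∈S       : lookup S x′ ≡ true
      u-covers-x : Dominating H (embed (S - x′) true false)
      x′-needed  : isDominating H′ (S - x′) ≡ false

  replaceable⇒ : ∀ {S} → T (replaceable S) → Replaceable S
  replaceable⇒ {S} r = record
    { x′∈S       = Equivalence.to T-≡ (proj₁ r₁)
    ; u-covers-x = proj₁ r₂
    ; x′-needed  = Equivalence.to T-not-≡ (proj₂ r₂)
    }
    where
    r₁ = Equivalence.to (T-∧ {lookup S x′}) r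
    r₂ = Equivalence.to (T-∧ {isDominating H (embed (S - x′) true false)}) (proj₂ r₁)

  ⇒replaceable : ∀ {S} → Replaceable S → T (replaceable S)
  ⇒replaceable r =
    Equivalence.from T-∧ (Equivalence.from T-≡ x′∈S , Equivalence.from T-∧ (u-covers-x , Equivalence.from T-not-≡ x′-needed))
    where open Replaceable r

  x′∈-replaceable : ∀ {S} → T (replaceable S) → x′ ∈ S
  x′∈-replaceable {S} r = lookup⇒[]= x′ S (Replaceable.x′∈S (replaceable⇒ {S} r))

  setOf : Subset m → Letter → Subset n
  setOf S V   = embed S false true
  setOf S U   = embed S true false
  setOf S UV  = embed S true true
  setOf S U′  = embed (S - x′) true false
  setOf S UV′ = embed (S - x′) true true

  setOf-dominating : ∀ {S} l → Dominating H′ S → T (allowed? (replaceable S) l) → Dominating H (setOf S l)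
  setOf-dominating V   dom _ = dominating-V dom
  setOf-dominating U   dom _ = dominating-U dom
  setOf-dominating UV  dom _ = dominating-add-v (dominating-U dom)
  setOf-dominating {S} U′  _ r = Replaceable.u-covers-x (replaceable⇒ {S} r)
  setOf-dominating {S} UV′ _ r = dominating-add-v (Replaceable.u-covers-x (replaceable⇒ {S} r))

  remove-x′-edge : ∀ {S} → T (replaceable S) → TarsAdj H′ S (S - x′)
  remove-x′-edge {S} r = TarsAdj-remove H′ (x′∈-replaceable {S} r)

  hand-back-edge : ∀ {S} → T (replaceable S) → TarsAdj H (setOf S UV′) (setOf S V)
  hand-back-edge {S} r = subst (λ Z → TarsAdj H (setOf S UV′) (embed Z false true)) (remove-add (x′∈-replaceable {S} r))
    (slide-u-x-edge (S - x′) (w∉X-w S x′))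

  letter-edge : ∀ {S} l l′ → T (allowed? (replaceable S) l) → T (allowed? (replaceable S) l′) → l ~ l′ →
                TarsAdj H (setOf S l) (setOf S l′)
  letter-edge {S} V   U   _ _ _ = slide-v-u-edge S
  letter-edge {S} U   V   _ _ _ = TarsAdj-sym H (slide-v-u-edge S)
  letter-edge {S} V   UV  _ _ _ = add-u-edge S true
  letter-edge {S} UV  V   _ _ _ = TarsAdj-sym H (add-u-edge S true)
  letter-edge {S} U   UV  _ _ _ = add-v-edge S true
  letter-edge {S} UV  U   _ _ _ = TarsAdj-sym H (add-v-edge S true)
  letter-edge {S} UV′ V   r _ _ = hand-back-edge {S} r
  letter-edge {S} V   UV′ _ r _ = TarsAdj-sym H (hand-back-edge {S} r)
  letter-edge {S} UV  UV′ _ r _ = lift-edge true true (remove-x′-edge {S} r)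
  letter-edge {S} UV′ UV  r _ _ = TarsAdj-sym H (lift-edge true true (remove-x′-edge {S} r))
  letter-edge {S} U   U′  _ r _ = lift-edge true false (remove-x′-edge {S} r)
  letter-edge {S} U′  U   r _ _ = TarsAdj-sym H (lift-edge true false (remove-x′-edge {S} r))
  letter-edge {S} U′  UV′ _ _ _ = add-v-edge (S - x′) true
  letter-edge {S} UV′ U′  _ _ _ = TarsAdj-sym H (add-v-edge (S - x′) true)

  open Blowup (TarsEdge H′) (replaceable ∘ proj₁) public

  toVertex : ValidCode → TarsVertex H
  toVertex (((S , dom) , l) , allowed) = setOf S l , setOf-dominating l dom allowed

  main-edge : ∀ {S S′} l → Main l → TarsAdj H′ S S′ → TarsAdj H (setOf S l) (setOf S′ l)
  main-edge V  _ = lift-edge false true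
  main-edge U  _ = lift-edge true false
  main-edge UV _ = lift-edge true true

  toVertex-edge : ∀ {c c′} → On Edge c c′ → TarsEdge H (toVertex c) (toVertex c′)
  toVertex-edge {((_ , l) , a)} {((_ , l′) , a′)} (inj₁ (refl , l~l′))      = letter-edge l l′ a a′ l~l′
  toVertex-edge {((_ , l) , _)} {_}               (inj₂ (refl , main , t~t′)) = main-edge l main t~t′

  letterOf : Bool → Bool → Bool → Letter
  letterOf false _     _     = V
  letterOf true  false true  = U
  letterOf true  true  true  = UV
  letterOf true  false false = U′
  letterOf true  true  false = UV′

  keyOf : Subset m → Bool → Bool → Bool → Subset m × Letter
  keyOf S bu bv true  = S , letterOf bu bv true
  keyOf S bu bv false = S ∪ ⁅ x′ ⁆ , letterOf bu bv false

  key : Subset n → Subset m × Letter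
  key D = keyOf (trace D) (lookup D u) (lookup D v) (isDominating H′ (trace D))

  key-embed : ∀ S bu bv → key (embed S bu bv) ≡ keyOf S bu bv (isDominating H′ S)
  key-embed S bu bv rewrite trace-embed S bu bv | lookup-embed-u S bu bv | lookup-embed-v S bu bv = refl

  key-setOf : ∀ {S} l → Dominating H′ S → T (allowed? (replaceable S) l) → key (setOf S l) ≡ (S , l)
  key-setOf {S} V   dom _ = trans (key-embed S false true) (cong (keyOf S false true) (Equivalence.to T-≡ dom))
  key-setOf {S} U   dom _ = trans (key-embed S true false) (cong (keyOf S true false) (Equivalence.to T-≡ dom))
  key-setOf {S} UV  dom _ = trans (key-embed S true true)  (cong (keyOf S true true)  (Equivalence.to T-≡ dom))
  key-setOf {S} U′  _   r = begin
    key (embed (S - x′) true false)                       ≡⟨ key-embed (S - x′) true false ⟩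
    keyOf (S - x′) true false (isDominating H′ (S - x′))  ≡⟨ cong (keyOf (S - x′) true false) (x′-needed (replaceable⇒ {S} r)) ⟩
    ((S - x′) ∪ ⁅ x′ ⁆ , U′)                              ≡⟨ cong (_, U′) (remove-add (x′∈-replaceable {S} r)) ⟩
    (S , U′)                                              ∎
    where open Replaceable
  key-setOf {S} UV′ _   r = begin
    key (embed (S - x′) true true)                        ≡⟨ key-embed (S - x′) true true ⟩
    keyOf (S - x′) true true (isDominating H′ (S - x′))   ≡⟨ cong (keyOf (S - x′) true true) (x′-needed (replaceable⇒ {S} r)) ⟩
    ((S - x′) ∪ ⁅ x′ ⁆ , UV′)                             ≡⟨ cong (_, UV′) (remove-add (x′∈-replaceable {S} r)) ⟩
    (S , UV′)                                             ∎
    where open Replaceable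

  toVertex-injective : Injective _≡_ _≡_ toVertex
  toVertex-injective {(((S , d) , l) , a)} {(((S′ , d′) , l′) , a′)} eq
    with trans (sym (key-setOf l d a)) (trans (cong (key ∘ proj₁) eq) (key-setOf l′ d′ a′))
  ... | refl = cong₂ (λ d a → ((S , d) , l) , a) (T-irrelevant d d′) (T-irrelevant a a′)

  uLetter uLetter′ : Bool → Letter
  uLetter false  = U
  uLetter true   = UV
  uLetter′ false = U′
  uLetter′ true  = UV′

  module _ {S : Subset m} where

    setOf-uLetter : ∀ bv → setOf S (uLetter bv) ≡ embed S true bv
    setOf-uLetter false = refl
    setOf-uLetter true  = refl

    setOf-uLetter′ : ∀ bv → setOf S (uLetter′ bv) ≡ embed (S - x′) true bv
    setOf-uLetter′ false = refl
    setOf-uLetter′ true  = refl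

  uLetter-allowed : ∀ {h} bv → T (allowed? h (uLetter bv))
  uLetter-allowed false = _
  uLetter-allowed true  = _

  uLetter′-allowed : ∀ {h} bv → T h → T (allowed? h (uLetter′ bv))
  uLetter′-allowed false r = r
  uLetter′-allowed true  r = r

  classify-embed : ∀ S bv → Dominating H (embed S true bv) → Σ[ c ∈ ValidCode ] proj₁ (toVertex c) ≡ embed S true bv
  classify-embed S bv dom with isDominating H′ S in S-dominating? | lookup S x′ in x′∈?S
  ... | true  | _     = (((S , Equivalence.from T-≡ S-dominating?) , uLetter bv) , uLetter-allowed bv) , setOf-uLetter bv
  ... | false | true  = ⊥-elim (subst T S-dominating? (dominating-x′∈ dom x′∈?S))
  ... | false | false =
    (((S ∪ ⁅ x′ ⁆ , dominating-∪x′ dom) , uLetter′ bv) , uLetter′-allowed bv (⇒replaceable replaceable-S∪x′)) ,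
    trans (setOf-uLetter′ bv) (cong (λ Z → embed Z true bv) restored)
    where
    restored : (S ∪ ⁅ x′ ⁆) - x′ ≡ S
    restored = add-remove (lookup≡false⇒∉ x′∈?S)
    replaceable-S∪x′ : Replaceable (S ∪ ⁅ x′ ⁆)
    replaceable-S∪x′ = record
      { x′∈S       = []=⇒lookup (w∈X∪⁅w⁆ S x′)
      ; u-covers-x = subst (λ Z → Dominating H (embed Z true false)) (sym restored) (dominating-drop-v bv dom)
      ; x′-needed  = trans (cong (isDominating H′) restored) S-dominating?
      }

  classify : ∀ D → Dominating H D → Σ[ c ∈ ValidCode ] proj₁ (toVertex c) ≡ D
  classify D dom with lookup D u in u∈?D
  ... | false = (((trace D , proj₂ facts) , V) , _) , sym (trans (embed-trace D) (cong₂ (embed (trace D)) u∈?D (proj₁ facts)))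
    where facts = dominating-u∉ D dom u∈?D
  ... | true  = proj₁ code , trans (proj₂ code) (sym D≡)
    where
    D≡ : D ≡ embed (trace D) true (lookup D v)
    D≡ = trans (embed-trace D) (cong (λ b → embed (trace D) b (lookup D v)) u∈?D)
    code = classify-embed (trace D) (lookup D v) (subst (Dominating H) D≡ dom)

  realise : (C : Cycle Edge) → All Allowed (vertices C) → Σ[ C′ ∈ Cycle (TarsEdge H) ] size C′ ≡ size C
  realise C allowed =
    mapCycle toVertex toVertex-injective (λ {c} {c′} → toVertex-edge {c} {c′}) (restrictCycle C allowed) ,
    trans (size-mapCycle {F = TarsEdge H} toVertex toVertex-injective (λ {c} {c′} → toVertex-edge {c} {c′})
                         (restrictCycle C allowed))
          (size-restrictCycle C allowed)

  blown-up-cycle : (C : Cycle (TarsEdge H′)) → 2 ≤ size C → ∀ R → R ≤ sum (map cap (vertices C)) →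
                  HasCycle (TarsVertex H) (TarsEdge H) (size C + size C + R)
  blown-up-cycle C 2≤size R R≤ with blowup C 2≤size R R≤
  ... | D , allowed , size-D with realise D allowed
  ...   | D′ , size-D′ = subst (HasCycle (TarsVertex H) (TarsEdge H)) (trans size-D′ size-D) (Cycle⇒HasCycle D′)

  triangle : TarsVertex H′ → HasCycle (TarsVertex H) (TarsEdge H) 3
  triangle t with realise (letterTriangle t) (_ ∷ _ ∷ _ ∷ [])
  ... | D′ , size-D′ = subst (HasCycle (TarsVertex H) (TarsEdge H)) size-D′ (Cycle⇒HasCycle D′)

  ε-size-bound : (C : Cycle (TarsEdge H′)) → (∀ t → t ∈ₗ vertices C) → ∀ {N} → Fin N ↔ TarsVertex H →
            N ≤ size C + size C + sum (map cap (vertices C))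
  ε-size-bound C complete {N} enum = subst (N ≤_) length≡ (complete⇒length≥ enum covered)
    where
    realised : List (TarsVertex H)
    realised = map toVertex (allowedCodes (vertices C))
    covered : ∀ D → D ∈ₗ realised
    covered (D , dom) with classify D dom
    ... | c , refl = subst (_∈ₗ realised) (Σ-T-≡ refl) (∈-map⁺ toVertex (∈-allowedCodes c (complete _)))
    length≡ : length realised ≡ size C + size C + sum (map cap (vertices C))
    length≡ = trans (length-map toVertex (allowedCodes (vertices C))) (length-allowedCodes (vertices C))

  doubled-cycle : ∀ {c r} → HasCycle (TarsVertex H′) (TarsEdge H′) c → 2 ≤ c → r ≤ 1 →
                  HasCycle (TarsVertex H) (TarsEdge H) (c + c + r)
  doubled-cycle cyc 2≤c r≤1 with HasCycle⇒Cycle cyc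
  ... | C , refl = blown-up-cycle C 2≤c _ (≤-trans r≤1 (capsum≥1 (vertices C) (s≤s z≤n)))

  long-cycle : ∀ {M ℓ N} → HasCycle (TarsVertex H′) (TarsEdge H′) M → Fin M ↔ TarsVertex H′ →
               Fin N ↔ TarsVertex H → 2 ≤ M → M + M ≤ ℓ → ℓ ≤ N → HasCycle (TarsVertex H) (TarsEdge H) ℓ
  long-cycle {ℓ = ℓ} {N} cyc enum′ enum 2≤M 2M≤ℓ ℓ≤N with HasCycle⇒Cycle cyc
  ... | C , refl = subst (HasCycle (TarsVertex H) (TarsEdge H)) (m+[n∸m]≡n 2M≤ℓ)
    (blown-up-cycle C 2≤M (ℓ ∸ (size C + size C)) (m≤n+o⇒m∸n≤o ℓ (size C + size C) (≤-trans ℓ≤N N≤)))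
    where
    N≤ : N ≤ size C + size C + sum (map cap (vertices C))
    N≤ = ε-size-bound C (unique⇒complete enum′ (unique C) refl) enum

-- Cycles of every length

halve : ∀ ℓ → Σ[ c ∈ ℕ ] Σ[ r ∈ ℕ ] r ≤ 1 × ℓ ≡ c + c + r
halve 0             = 0 , 0 , z≤n , refl
halve 1             = 0 , 1 , s≤s z≤n , refl
halve (suc (suc ℓ)) with halve ℓ
... | c , r , r≤1 , refl = suc c , r , r≤1 , cong suc (cong (_+ r) (sym (+-suc c c)))

half≥2 : ∀ {c r} → r ≤ 1 → 4 ≤ c + c + r → 2 ≤ c
half≥2 {suc (suc c)} _        _                           = s≤s (s≤s z≤n)
half≥2 {0} {0}             _        ()
half≥2 {0} {1}             _        (s≤s ())
half≥2 {0} {suc (suc _)}   (s≤s ()) _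
half≥2 {1} {0}             _        (s≤s (s≤s ()))
half≥2 {1} {1}             _        (s≤s (s≤s (s≤s ())))
half≥2 {1} {suc (suc _)}   (s≤s ()) _

mainTheorem1 : ∀ {n m : ℕ} (H : SimpleGraph n) (u v x : Fin n) →
    x ≢ v →
    (∀ w → (Adj H u w → w ≡ x ⊎ w ≡ v) × (w ≡ x ⊎ w ≡ v → Adj H u w)) →
    (∀ w → (Adj H v w → w ≡ u) × (w ≡ u → Adj H v w)) →
    (H' : SimpleGraph m) (ι : Fin m → Fin n) → IsDeletion2 H u v H' ι →
    Connected H' → 2 ≤ m →
    TarsPancyclic H' → TarsPancyclic H
mainTheorem1 H u v x x≢v hu hv H′ ι del connected 2≤m pancyclic N enum = cycle
  where
  open Pendant H u v x x≢v hu hv H′ ι del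
  M = length (dominatingSets H′)
  3≤M = three≤#dominatingSets H′ connected 2≤m
  hamiltonian = pancyclic M (enumerate-ε H′) M 3≤M ≤-refl

  cycleOfSize : ∀ c → 2 ≤ c → c ≤ M → HasCycle (TarsVertex H′) (TarsEdge H′) c
  cycleOfSize 1                   (s≤s ()) _
  cycleOfSize 2                   _ _   =
    HasCycle-digon {E = TarsEdge H′} (λ {p} {q} → TarsEdge-sym H′ {p} {q}) hamiltonian (<⇒≤ 3≤M)
  cycleOfSize (suc (suc (suc c))) _ c≤M = pancyclic M (enumerate-ε H′) _ (s≤s (s≤s (s≤s z≤n))) c≤M

  cycle : ∀ ℓ → 3 ≤ ℓ → ℓ ≤ N → HasCycle (TarsVertex H) (TarsEdge H) ℓ
  cycle ℓ 3≤ℓ ℓ≤N with m≤n⇒m<n∨m≡n 3≤ℓ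
  ... | inj₂ refl = triangle (full , full-dominating H′)
  ... | inj₁ 4≤ℓ with halve ℓ
  ...   | c , r , r≤1 , refl with c ≤? M
  ...     | yes c≤M = doubled-cycle (cycleOfSize c (half≥2 r≤1 4≤ℓ) c≤M) (half≥2 r≤1 4≤ℓ) r≤1
  ...     | no  c≰M = long-cycle hamiltonian (enumerate-ε H′) enum (<⇒≤ 3≤M) 2M≤ℓ ℓ≤N
    where
    M≤c = <⇒≤ (≰⇒> c≰M)
    2M≤ℓ = ≤-trans (+-mono-≤ M≤c M≤c) (m≤m+n (c + c) r)
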